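{- Let $q$ be a power of a prime $p\neq2,3$ and let $E': y^2=x^3+A'x+B'$ be an elliptic curve over $\mathbb{F}_q$. (1) Suppose $j(E')=1728$. Then $\mathrm{Hess}(E')$ has $j$-invariant $1728$, and it is a proper twist of $E'$ if and only if $-3(A')^2\notin(\mathbb{F}_q^*)^4$. Moreover: (a) if $q\equiv3\pmod 4$, then $\mathrm{Twist}(E')$ has two elements, and one of them is (up to $\mathbb{F}_q$-isomorphism) the Hessian of two curves of $j$-invariant $-8\cdot1728$, one a proper twist of the other; (b) if $q\equiv1\pmod4$, then $\mathrm{Twist}(E')$ has four elements, two of which are, respectively, the Hessian of an elliptic curve of $j$-invariant $-8\cdot1728$ and the Hessian of its proper twist. (2) Suppose $j(E')=0$. Then: (a) if $q\equiv2\pmod3$, then $\mathrm{Twist}(E')$ consists of a pair of quadratic twists, which are the Hessians of two elliptic curves of $j$-invariant $4\cdot1728$, one a quadratic twist of the other; (b) if $q\equiv1\pmod 3$, then $\mathrm{Twist}(E')$ has three pairs of elements, each pair consisting of an elliptic curve and its quadratic twist, and one of the pairs is the Hessian of three $\mathbb{F}_q$-isomorphic curves of $j$-invariant $4\cdot1728$.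
   Context: For an elliptic curve $E: y^2=x^3+Ax+B$ over $\mathbb{F}_q$ with $A\neq0$, $\mathrm{Hess}(E)$ denotes the curve $y^2=x^3-\frac{A^3/3+3B^2}{A^4}x-\frac{A^3B/3+2B^3}{A^6}$ (the short Weierstrass model of the Hessian cubic, i.e. the determinant of the Hessian matrix of $X^3+AXZ^2+BZ^3-Y^2Z$); "the Hessian of" is understood up to $\mathbb{F}_q$-isomorphism. $\mathrm{Twist}(E')$ is the set of elliptic curves over $\mathbb{F}_q$ that are $\overline{\mathbb{F}_q}$-isomorphic to $E'$, up to $\mathbb{F}_q$-isomorphism; a proper twist of $E'$ is an element of $\mathrm{Twist}(E')$ not $\mathbb{F}_q$-isomorphic to $E'$; the quadratic twist of $y^2=x^3+ax+b$ is $y^2=x^3+D^2ax+D^3b$ with $D$ a non-square in $\mathbb{F}_q$. -}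

module Defs where

open import Level using (Level; 0ℓ) renaming (suc to lsuc)
open import Data.Nat as ℕ using (ℕ; zero; suc)
open import Data.Fin using (Fin; splitAt)
open import Data.Sum using (_⊎_; [_,_]′)
open import Data.Product using (Σ; Σ-syntax; _×_; _,_; ∃; ∃-syntax)
open import Relation.Binary.PropositionalEquality using (_≡_; _≢_)
open import Relation.Nullary using (¬_)
open import Function.Bundles using (_↔_)
open import Algebra.Core using (Op₁; Op₂)
import Algebra.Structures as AS

record Field : Set₁ where
  infixl 6 _+_
  infixl 7 _*_
  field
    Carrier  : Set
    _+_ _*_  : Op₂ Carrier
    -_       : Op₁ Carrier
    0# 1#    : Carrier
    _⁻¹      : Op₁ Carrier
    isCommutativeRing : AS.IsCommutativeRing _≡_ _+_ _*_ -_ 0# 1#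
    0≢1      : 0# ≢ 1#
    inverse  : ∀ x → x ≢ 0# → x * (x ⁻¹) ≡ 1#

  ι : ℕ → Carrier
  ι zero    = 0#
  ι (suc n) = 1# + ι n

  _^_ : Carrier → ℕ → Carrier
  x ^ zero  = 1#
  x ^ suc n = x * (x ^ n)

  _-_ : Op₂ Carrier
  x - y = x + (- y)

  -- x / y := x * y⁻¹ (only used with y ≠ 0)
  _/_ : Op₂ Carrier
  x / y = x * (y ⁻¹)

record FiniteField : Set₁ where
  field
    field'  : Field
    size    : ℕ
    enum    : Field.Carrier field' ↔ Fin size
  open Field field' public

-- field homomorphisms (used for field extensions K ⊇ F)
record FieldHom (F K : Field) : Set where
  private
    module F = Field F
    module K = Field K
  field
    map   : F.Carrier → K.Carrier
    map-+ : ∀ x y → map (x F.+ y) ≡ map x K.+ map y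
    map-* : ∀ x y → map (x F.* y) ≡ map x K.* map y
    map-1 : map F.1# ≡ K.1#

-- Short Weierstrass equations y² = x³ + a x + b over a field

module EC (F : Field) where
  open Field F

  record W : Set where
    constructor mkW
    field
      a b : Carrier
  open W public

  -- discriminant-type quantity 4a³ + 27b²; the equation is an elliptic
  -- curve iff it is nonzero (char ≠ 2,3)
  δ : W → Carrier
  δ E = ι 4 * (a E ^ 3) + ι 27 * (b E ^ 2)

  IsEC : W → Set
  IsEC E = δ E ≢ 0#

  j : W → Carrier
  j E = ι 1728 * (ι 4 * (a E ^ 3)) / δ E

  Hess : W → W
  Hess E = mkW
    (- (((A ^ 3) / ι 3 + ι 3 * (B ^ 2)) / (A ^ 4)))
    (- (((A ^ 3) * B / ι 3 + ι 2 * (B ^ 3)) / (A ^ 6)))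
    where
      A = a E
      B = b E

  Iso : W → W → Set
  Iso E T = Σ[ u ∈ Carrier ] (u ≢ 0#) × (a T ≡ (u ^ 4) * a E) × (b T ≡ (u ^ 6) * b E)

  -- isomorphism over some field extension K of F (equivalently, over F̄)
  IsoBar : W → W → Set₁
  IsoBar E T =
    Σ[ K ∈ Field ] Σ[ h ∈ FieldHom F K ] Σ[ u ∈ Field.Carrier K ]
      let open Field K renaming (_*_ to _*K_; _^_ to _^K_; 0# to 0K)
          hm = FieldHom.map h
      in (u ≢ 0K) × (hm (a T) ≡ (u ^K 4) *K hm (a E))
                  × (hm (b T) ≡ (u ^K 6) *K hm (b E))

  -- T ∈ Twist(E): an elliptic curve over F that is F̄-isomorphic to E
  Twist : W → W → Set₁
  Twist E T = IsEC T × IsoBar E T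

  ProperTwist : W → W → Set₁
  ProperTwist E T = Twist E T × ¬ Iso E T

  NonSquare : Carrier → Set
  NonSquare D = ¬ (Σ[ x ∈ Carrier ] x * x ≡ D)

  qtw : Carrier → W → W
  qtw D E = mkW ((D ^ 2) * a E) ((D ^ 3) * b E)

  IsQuadTwist : W → W → Set
  IsQuadTwist E T = Σ[ D ∈ Carrier ] NonSquare D × Iso T (qtw D E)

  -- f lists the elements of Twist(E) up to F-isomorphism, without repetition
  TwistElems : ∀ {n} → W → (Fin n → W) → Set₁
  TwistElems {n} E f =
    (∀ i → Twist E (f i)) ×
    (∀ i k → i ≢ k → ¬ Iso (f i) (f k)) ×
    (∀ T → Twist E T → Σ[ i ∈ Fin n ] Iso T (f i))

  TwistCard : W → ℕ → Set₁
  TwistCard E n = Σ[ f ∈ (Fin n → W) ] TwistElems E f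

  -- the 2k curves  g 0, …, g (k-1), qtw D (g 0), …, qtw D (g (k-1))
  pairs : ∀ k → (Fin k → W) → Carrier → Fin (k ℕ.+ k) → W
  pairs k g D i = [ g , (λ m → qtw D (g m)) ]′ (splitAt k i)

  HessOfThree : W → Set
  HessOfThree T =
    Σ[ E₁ ∈ W ] Σ[ E₂ ∈ W ] Σ[ E₃ ∈ W ]
      (IsEC E₁ × IsEC E₂ × IsEC E₃) ×
      (j E₁ ≡ ι 4 * ι 1728) × (j E₂ ≡ ι 4 * ι 1728) × (j E₃ ≡ ι 4 * ι 1728) ×
      (E₁ ≢ E₂) × (E₁ ≢ E₃) × (E₂ ≢ E₃) ×
      Iso E₁ E₂ × Iso E₁ E₃ × Iso E₂ E₃ ×
      (Hess E₁ ≡ Hess E₂) × (Hess E₁ ≡ Hess E₃) ×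
      Iso (Hess E₁) T

{-# OPTIONS --safe #-}

-- Over a field of characteristic ≠ 2, 3 a curve with j = 1728 is y² = x³ + a x and one with
-- j = 0 is y² = x³ + b. Their twists are the curves of the same shape, and two of these are
-- isomorphic over F exactly when the a's differ by a fourth power (the b's by a sixth power),
-- which over F̄ can always be arranged: the required roots are adjoined by explicit quadratic and
-- cubic extensions. So Twist(E') is F*/F*⁴, resp. F*/F*⁶. Over F_q these quotients are read
-- off with Fermat's little theorem and root counting: if k m = q - 1, a unit c is a k-th power
-- iff c^m = 1, the characters x ↦ x^m separate the classes, and every unit is a k-th power
-- when k is prime to q - 1. The Hessians are explicit: that of y² = x³ + a x is
-- y² = x³ - x/(3a), that of y² = x³ - 6s²x + 6s³ (j = -8·1728) is y² = x³ - x/(36 s²), and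
-- that of y² = x³ - 9s²x + 9s³ (j = 4·1728) is y² = x³ + 1/(729 s³), which only depends on s³.

module Submission where

open import Defs
open import Level using (0ℓ)
open import Algebra.Bundles using (CommutativeRing)
open import Algebra.Core using (Op₁; Op₂)
open import Algebra.Structures using (IsCommutativeRing)
import Algebra.Properties.Ring as RingProperties
import Algebra.Solver.Ring as RingSolver
open import Algebra.Solver.Ring.AlmostCommutativeRing using (fromCommutativeRing; _-Raw-AlmostCommutative⟶_)
open import Data.Empty using (⊥; ⊥-elim)
open import Data.Fin as Fin using (Fin; toℕ; combine; remQuot)
import Data.Fin.Properties as Fin
open import Data.Fin.Patterns using (0F; 1F; 2F)
open import Data.Integer as ℤ using (ℤ; -[1+_]; _⊖_; sign; ∣_∣; _◃_)
import Data.Integer.Properties as ℤ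
open import Data.List as List using (List; []; _∷_; filter; length; allFin; replicate; _++_; foldr; tabulate; cartesianProduct)
import Data.List.Properties as List
open import Data.List.Membership.Propositional using (_∈_; find)
import Data.List.Membership.Propositional.Properties as ∈
open import Data.List.Membership.Propositional.Properties.WithK using (unique∧set⇒bag)
open import Data.List.Relation.Binary.BagAndSetEquality using (∼bag⇒↭)
open import Data.List.Relation.Binary.Permutation.Propositional using (_↭_; ↭⇒↭ₛ)
open import Data.List.Relation.Binary.Permutation.Propositional.Properties using (↭-length)
import Data.List.Relation.Binary.Permutation.Setoid.Properties as PermutationSetoid
open import Data.List.Relation.Unary.All as All using (All; []; _∷_)
import Data.List.Relation.Unary.All.Properties as All
open import Data.List.Relation.Unary.AllPairs using ([]; _∷_)
open import Data.List.Relation.Unary.Any using (here; there; any?; satisfied)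
open import Data.List.Relation.Unary.Unique.Propositional using (Unique)
import Data.List.Relation.Unary.Unique.Propositional.Properties as Unique
import Data.Maybe as Maybe
open import Data.Nat as ℕ using (ℕ; zero; suc; _∸_; z≤n; s≤s)
import Data.Nat.Properties as ℕ
open import Data.Nat.Coprimality using (Coprime; coprime-Bézout; prime⇒coprime)
open import Data.Nat.DivMod using (m≡m%n+[m/n]*n; m%n<n)
open import Data.Nat.GCD using (module Bézout)
open import Data.Nat.Primality using (Prime; prime⇒nonTrivial)
open import Data.Nat.Solver using (module +-*-Solver)
open import Data.Product using (Σ; Σ-syntax; _×_; _,_; proj₁; proj₂; uncurry)
import Data.Product.Properties as Product
open import Data.Sign as Sign using (Sign)
open import Function.Bundles using (Inverse; _⇔_; mk⇔; Equivalence)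
open import Relation.Binary.Consequences using (dec⇒weaklyDec)
open import Relation.Binary.Definitions using (DecidableEquality; tri<; tri≈; tri>)
open import Relation.Binary.PropositionalEquality
open import Relation.Nullary using (¬_; Dec; yes; no; ¬?)
open import Relation.Nullary.Decidable using (map′; decidable-stable)

[1+k][1+n]≡1+n[1+k]+k : ∀ k n → suc k ℕ.* suc n ≡ suc (n ℕ.* suc k) ℕ.+ k
[1+k][1+n]≡1+n[1+k]+k = solve 2 (λ k n → (con 1 :+ k) :* (con 1 :+ n) := (con 1 :+ n :* (con 1 :+ k)) :+ k) refl
  where open +-*-Solver

[kt+1][1+k]≡[[1+k]t+1]k+1 : ∀ k t → (k ℕ.* t ℕ.+ 1) ℕ.* suc k ≡ (suc k ℕ.* t ℕ.+ 1) ℕ.* k ℕ.+ 1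
[kt+1][1+k]≡[[1+k]t+1]k+1 = solve 2 (λ k t → (k :* t :+ con 1) :* (con 1 :+ k) := ((con 1 :+ k) :* t :+ con 1) :* k :+ con 1) refl
  where open +-*-Solver

module _ {N q : ℕ} (1+N≡q : suc N ≡ q) where

  private
    N≡r+[q/n]n : ∀ n r .{{_ : ℕ.NonZero n}} → q ℕ.% n ≡ suc r → N ≡ r ℕ.+ (q ℕ./ n) ℕ.* n
    N≡r+[q/n]n n r q%n≡1+r = ℕ.suc-injective (trans 1+N≡q (trans (m≡m%n+[m/n]*n q n) (cong (ℕ._+ (q ℕ./ n) ℕ.* n) q%n≡1+r)))

  q%4≡3⇒ : q ℕ.% 4 ≡ 3 → 2 ℕ.* suc (2 ℕ.* (q ℕ./ 4)) ≡ N
  q%4≡3⇒ q%4≡3 = trans (solve 1 (λ t → con 2 :* (con 1 :+ con 2 :* t) := con 2 :+ t :* con 4) refl (q ℕ./ 4))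
                       (sym (N≡r+[q/n]n 4 2 q%4≡3))
    where open +-*-Solver

  q%4≡1⇒ : q ℕ.% 4 ≡ 1 → 4 ℕ.* (q ℕ./ 4) ≡ N
  q%4≡1⇒ q%4≡1 = trans (ℕ.*-comm 4 (q ℕ./ 4)) (sym (N≡r+[q/n]n 4 0 q%4≡1))

  q%3≡2⇒ : q ℕ.% 3 ≡ 2 → 3 ℕ.* (q ℕ./ 3) ℕ.+ 1 ≡ N
  q%3≡2⇒ q%3≡2 = trans (solve 1 (λ t → con 3 :* t :+ con 1 := con 1 :+ t :* con 3) refl (q ℕ./ 3))
                       (sym (N≡r+[q/n]n 3 1 q%3≡2))
    where open +-*-Solver

  q%3≡1⇒ : q ℕ.% 3 ≡ 1 → 3 ℕ.* (q ℕ./ 3) ≡ N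
  q%3≡1⇒ q%3≡1 = trans (ℕ.*-comm 3 (q ℕ./ 3)) (sym (N≡r+[q/n]n 3 0 q%3≡1))

module FieldProperties (F : Field) where

  open Field F public

  commutativeRing : CommutativeRing 0ℓ 0ℓ
  commutativeRing = record { isCommutativeRing = isCommutativeRing }

  open CommutativeRing commutativeRing public
    using ( +-assoc; +-comm; +-identityˡ; +-identityʳ; -‿inverseˡ; -‿inverseʳ
          ; *-assoc; *-comm; *-identityˡ; *-identityʳ; distribˡ; zeroˡ; zeroʳ; ring )
  open RingProperties ring public
    using (-‿involutive; -0#≈0#; -‿distribˡ-*; -‿distribʳ-*; -‿+-comm)

  ι-+ : ∀ m n → ι (m ℕ.+ n) ≡ ι m + ι n
  ι-+ zero    n = sym (+-identityˡ _)
  ι-+ (suc m) n = trans (cong (1# +_) (ι-+ m n)) (sym (+-assoc _ _ _))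

  ι-* : ∀ m n → ι (m ℕ.* n) ≡ ι m * ι n
  ι-* zero    n = sym (zeroˡ _)
  ι-* (suc m) n = begin
    ι (n ℕ.+ m ℕ.* n)      ≡⟨ ι-+ n (m ℕ.* n) ⟩
    ι n + ι (m ℕ.* n)      ≡⟨ cong (ι n +_) (ι-* m n) ⟩
    ι n + ι m * ι n        ≡⟨ cong (_+ ι m * ι n) (*-identityˡ _) ⟨
    1# * ι n + ι m * ι n   ≡⟨ CommutativeRing.distribʳ commutativeRing _ _ _ ⟨
    (1# + ι m) * ι n       ∎
    where open ≡-Reasoning

  ι-^ : ∀ m k → ι (m ℕ.^ k) ≡ ι m ^ k
  ι-^ m zero    = +-identityʳ 1#
  ι-^ m (suc k) = trans (ι-* m (m ℕ.^ k)) (cong (ι m *_) (ι-^ m k))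

  ι-coprime : ∀ {m n} → Coprime m n → ι m ≡ 0# → ι n ≢ 0#
  ι-coprime {m} {n} m⊥n ιm≡0 ιn≡0 = from-Bézout (coprime-Bézout m⊥n)
    where
    ι[k*_]≡0 : ∀ k {l} → ι l ≡ 0# → ι (k ℕ.* l) ≡ 0#
    ι[k*_]≡0 k {l} ιl≡0 = trans (ι-* k l) (trans (cong (ι k *_) ιl≡0) (zeroʳ _))
    consecutive-zeros : ∀ a b → suc a ≡ b → ι a ≡ 0# → ι b ≡ 0# → ⊥
    consecutive-zeros a b 1+a≡b ιa≡0 ιb≡0 = 0≢1 (begin
      0#            ≡⟨ ιb≡0 ⟨
      ι b           ≡⟨ cong ι 1+a≡b ⟨
      1# + ι a      ≡⟨ cong (1# +_) ιa≡0 ⟩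
      1# + 0#       ≡⟨ +-identityʳ 1# ⟩
      1#            ∎)
      where open ≡-Reasoning
    from-Bézout : Bézout.Identity 1 m n → ⊥
    from-Bézout (Bézout.+- x y 1+yn≡xm) = consecutive-zeros (y ℕ.* n) (x ℕ.* m) 1+yn≡xm (ι[k*_]≡0 y ιn≡0) (ι[k*_]≡0 x ιm≡0)
    from-Bézout (Bézout.-+ x y 1+xm≡yn) = consecutive-zeros (x ℕ.* m) (y ℕ.* n) 1+xm≡yn (ι[k*_]≡0 x ιm≡0) (ι[k*_]≡0 y ιn≡0)

  ιℤ : ℤ → Carrier
  ιℤ (ℤ.+ n)    = ι n
  ιℤ -[1+ n ]   = - ι (suc n)

  private
    ιₛ : Sign → ℕ → Carrier
    ιₛ Sign.+ n = ι n
    ιₛ Sign.- n = - ι n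

    ιℤ-◃ : ∀ s n → ιℤ (s ◃ n) ≡ ιₛ s n
    ιℤ-◃ Sign.+ zero    = refl
    ιℤ-◃ Sign.- zero    = sym -0#≈0#
    ιℤ-◃ Sign.+ (suc n) = refl
    ιℤ-◃ Sign.- (suc n) = refl

    ιₛ-* : ∀ s t m n → ιₛ (s Sign.* t) (m ℕ.* n) ≡ ιₛ s m * ιₛ t n
    ιₛ-* Sign.+ Sign.+ m n = ι-* m n
    ιₛ-* Sign.+ Sign.- m n = trans (cong -_ (ι-* m n)) (-‿distribʳ-* _ _)
    ιₛ-* Sign.- Sign.+ m n = trans (cong -_ (ι-* m n)) (-‿distribˡ-* _ _)
    ιₛ-* Sign.- Sign.- m n = begin
      ι (m ℕ.* n)           ≡⟨ ι-* m n ⟩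
      ι m * ι n             ≡⟨ -‿involutive _ ⟨
      - - (ι m * ι n)       ≡⟨ cong -_ (-‿distribʳ-* _ _) ⟩
      - (ι m * - ι n)       ≡⟨ -‿distribˡ-* _ _ ⟩
      - ι m * - ι n         ∎
      where open ≡-Reasoning

    ιℤ-sign : ∀ i → ιℤ i ≡ ιₛ (sign i) ∣ i ∣
    ιℤ-sign (ℤ.+ n)    = refl
    ιℤ-sign -[1+ n ]   = refl

    ιℤ-⊖ : ∀ m n → ιℤ (m ⊖ n) ≡ ι m - ι n
    ιℤ-⊖ m       zero    = begin
      ιℤ (m ⊖ 0)   ≡⟨ cong ιℤ (ℤ.⊖-≥ {m} {0} ℕ.z≤n) ⟩
      ι m          ≡⟨ +-identityʳ _ ⟨
      ι m + 0#     ≡⟨ cong (ι m +_) -0#≈0# ⟨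
      ι m - 0#     ∎
      where open ≡-Reasoning
    ιℤ-⊖ zero    (suc n) = sym (+-identityˡ _)
    ιℤ-⊖ (suc m) (suc n) = begin
      ιℤ (suc m ⊖ suc n)              ≡⟨ cong ιℤ (ℤ.[1+m]⊖[1+n]≡m⊖n m n) ⟩
      ιℤ (m ⊖ n)                      ≡⟨ ιℤ-⊖ m n ⟩
      ι m - ι n                       ≡⟨ +-identityˡ _ ⟨
      0# + (ι m - ι n)                ≡⟨ cong (_+ (ι m - ι n)) (-‿inverseʳ 1#) ⟨
      (1# - 1#) + (ι m - ι n)         ≡⟨ +-assoc 1# (- 1#) _ ⟩
      1# + ((- 1#) + (ι m - ι n))     ≡⟨ cong (1# +_) (+-assoc (- 1#) (ι m) _) ⟨
      1# + (((- 1#) + ι m) - ι n)     ≡⟨ cong (λ t → 1# + (t - ι n)) (+-comm (- 1#) (ι m)) ⟩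
      1# + ((ι m - 1#) - ι n)         ≡⟨ cong (1# +_) (+-assoc (ι m) (- 1#) _) ⟩
      1# + (ι m + ((- 1#) - ι n))     ≡⟨ +-assoc 1# (ι m) _ ⟨
      (1# + ι m) + ((- 1#) - ι n)     ≡⟨ cong ((1# + ι m) +_) (-‿+-comm 1# (ι n)) ⟩
      (1# + ι m) + - (1# + ι n)       ∎
      where open ≡-Reasoning

  ιℤ-+ : ∀ i j → ιℤ (i ℤ.+ j) ≡ ιℤ i + ιℤ j
  ιℤ-+ (ℤ.+ m)   (ℤ.+ n)   = ι-+ m n
  ιℤ-+ (ℤ.+ m)   -[1+ n ]  = ιℤ-⊖ m (suc n)
  ιℤ-+ -[1+ m ]  (ℤ.+ n)   = trans (ιℤ-⊖ n (suc m)) (+-comm _ _)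
  ιℤ-+ -[1+ m ]  -[1+ n ]  = begin
    - (1# + ι (suc (m ℕ.+ n)))    ≡⟨ cong (λ t → - (1# + t)) (ι-+ (suc m) n) ⟩
    - (1# + (ι (suc m) + ι n))    ≡⟨ cong -_ (+-assoc 1# (ι (suc m)) (ι n)) ⟨
    - ((1# + ι (suc m)) + ι n)    ≡⟨ cong (λ t → - (t + ι n)) (+-comm 1# (ι (suc m))) ⟩
    - ((ι (suc m) + 1#) + ι n)    ≡⟨ cong -_ (+-assoc (ι (suc m)) 1# (ι n)) ⟩
    - (ι (suc m) + ι (suc n))     ≡⟨ -‿+-comm _ _ ⟨
    - ι (suc m) + - ι (suc n)     ∎
    where open ≡-Reasoning

  ιℤ-* : ∀ i j → ιℤ (i ℤ.* j) ≡ ιℤ i * ιℤ j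
  ιℤ-* i j = begin
    ιℤ (i ℤ.* j)                                 ≡⟨ ιℤ-◃ (sign i Sign.* sign j) (∣ i ∣ ℕ.* ∣ j ∣) ⟩
    ιₛ (sign i Sign.* sign j) (∣ i ∣ ℕ.* ∣ j ∣)   ≡⟨ ιₛ-* (sign i) (sign j) ∣ i ∣ ∣ j ∣ ⟩
    ιₛ (sign i) ∣ i ∣ * ιₛ (sign j) ∣ j ∣         ≡⟨ cong₂ _*_ (ιℤ-sign i) (ιℤ-sign j) ⟨
    ιℤ i * ιℤ j                                  ∎
    where open ≡-Reasoning

  ιℤ-neg : ∀ i → ιℤ (ℤ.- i) ≡ - ιℤ i
  ιℤ-neg (ℤ.+ zero)   = sym -0#≈0#
  ιℤ-neg (ℤ.+ suc n)  = refl
  ιℤ-neg -[1+ n ]     = sym (-‿involutive _)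

  -- ιℤ with 0 and 1 special-cased, so that the constants 0 and 1 of a
  -- solver expression denote 0# and 1# on the nose.
  private
    coeff : ℤ → Carrier
    coeff (ℤ.+ 0)  = 0#
    coeff (ℤ.+ 1)  = 1#
    coeff i        = ιℤ i

    coeff≡ιℤ : ∀ i → coeff i ≡ ιℤ i
    coeff≡ιℤ (ℤ.+ 0)            = refl
    coeff≡ιℤ (ℤ.+ 1)            = sym (+-identityʳ 1#)
    coeff≡ιℤ (ℤ.+ suc (suc n))  = refl
    coeff≡ιℤ -[1+ n ]           = refl

    homo₂ : ∀ {f : ℤ → ℤ → ℤ} {g : Carrier → Carrier → Carrier} →
            (∀ i j → ιℤ (f i j) ≡ g (ιℤ i) (ιℤ j)) →
            ∀ i j → coeff (f i j) ≡ g (coeff i) (coeff j)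
    homo₂ {f} {g} h i j = trans (coeff≡ιℤ (f i j))
      (trans (h i j) (sym (cong₂ g (coeff≡ιℤ i) (coeff≡ιℤ j))))

    morphism : ℤ.+-*-rawRing -Raw-AlmostCommutative⟶ fromCommutativeRing commutativeRing
    morphism = record
      { ⟦_⟧    = coeff
      ; +-homo = homo₂ {ℤ._+_} {_+_} ιℤ-+
      ; *-homo = homo₂ {ℤ._*_} {_*_} ιℤ-*
      ; -‿homo = λ i → trans (coeff≡ιℤ (ℤ.- i)) (trans (ιℤ-neg i) (sym (cong -_ (coeff≡ιℤ i))))
      ; 0-homo = refl
      ; 1-homo = refl
      }

    coeff≟ : ∀ i j → Maybe.Maybe (coeff i ≡ coeff j)
    coeff≟ i j = Maybe.map (cong coeff) (dec⇒weaklyDec ℤ._≟_ i j)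

  open RingSolver ℤ.+-*-rawRing (fromCommutativeRing commutativeRing) morphism coeff≟ public
    using (Polynomial; solve; _:=_; _:+_; _:*_; _:-_; :-_; _:^_; con)

  infix 10 #_
  #_ : ∀ {m} → ℕ → Polynomial m
  # n = con (ℤ.+ n)

  1≢0 : 1# ≢ 0#
  1≢0 = ≢-sym 0≢1

  x*y≡0⇒y≡0 : ∀ {x y} → x ≢ 0# → x * y ≡ 0# → y ≡ 0#
  x*y≡0⇒y≡0 {x} {y} x≢0 xy≡0 = begin
    y                  ≡⟨ *-identityˡ y ⟨
    1# * y             ≡⟨ cong (_* y) (trans (*-comm _ _) (inverse x x≢0)) ⟨
    (x ⁻¹ * x) * y     ≡⟨ *-assoc _ _ _ ⟩
    x ⁻¹ * (x * y)     ≡⟨ cong (x ⁻¹ *_) xy≡0 ⟩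
    x ⁻¹ * 0#          ≡⟨ zeroʳ _ ⟩
    0#                 ∎
    where open ≡-Reasoning

  x*y≢0 : ∀ {x y} → x ≢ 0# → y ≢ 0# → x * y ≢ 0#
  x*y≢0 x≢0 y≢0 xy≡0 = y≢0 (x*y≡0⇒y≡0 x≢0 xy≡0)

  x^n≢0 : ∀ {x} n → x ≢ 0# → x ^ n ≢ 0#
  x^n≢0 zero    x≢0 = 1≢0
  x^n≢0 (suc n) x≢0 = x*y≢0 x≢0 (x^n≢0 n x≢0)

  x^n≢0⇒x≢0 : ∀ {x} n → 0 ℕ.< n → x ^ n ≢ 0# → x ≢ 0#
  x^n≢0⇒x≢0 {x} (suc n) _ xⁿ≢0 x≡0 = xⁿ≢0 (trans (cong (λ t → t * x ^ n) x≡0) (zeroˡ _))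

  xⁿ≡1⇒x≢0 : ∀ {x} n → 0 ℕ.< n → x ^ n ≡ 1# → x ≢ 0#
  xⁿ≡1⇒x≢0 n 0<n xⁿ≡1 = x^n≢0⇒x≢0 n 0<n (subst (_≢ 0#) (sym xⁿ≡1) 1≢0)

  -x≢0 : ∀ {x} → x ≢ 0# → - x ≢ 0#
  -x≢0 {x} x≢0 -x≡0 = x≢0 (trans (sym (-‿involutive x)) (trans (cong -_ -x≡0) -0#≈0#))

  x-y≡0⇒x≡y : ∀ {x y} → x - y ≡ 0# → x ≡ y
  x-y≡0⇒x≡y {x} {y} x-y≡0 = begin
    x                ≡⟨ +-identityʳ x ⟨
    x + 0#           ≡⟨ cong (x +_) (-‿inverseˡ y) ⟨
    x + (- y + y)    ≡⟨ +-assoc _ _ _ ⟨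
    (x - y) + y      ≡⟨ cong (_+ y) x-y≡0 ⟩
    0# + y           ≡⟨ +-identityˡ y ⟩
    y                ∎
    where open ≡-Reasoning

  *-cancelˡ : ∀ {x y z} → x ≢ 0# → x * y ≡ x * z → y ≡ z
  *-cancelˡ {x} {y} {z} x≢0 xy≡xz = x-y≡0⇒x≡y (x*y≡0⇒y≡0 x≢0 x[y-z]≡0)
    where
    x[y-z]≡0 : x * (y - z) ≡ 0#
    x[y-z]≡0 = begin
      x * (y - z)          ≡⟨ distribˡ x y (- z) ⟩
      x * y + x * (- z)    ≡⟨ cong₂ _+_ xy≡xz (sym (-‿distribʳ-* x z)) ⟩
      (x * z) - (x * z)    ≡⟨ -‿inverseʳ _ ⟩
      0#                   ∎
      where open ≡-Reasoning

  ⁻¹-inverseˡ : ∀ {x} → x ≢ 0# → x ⁻¹ * x ≡ 1#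
  ⁻¹-inverseˡ {x} x≢0 = trans (*-comm _ _) (inverse x x≢0)

  x⁻¹≢0 : ∀ {x} → x ≢ 0# → x ⁻¹ ≢ 0#
  x⁻¹≢0 {x} x≢0 x⁻¹≡0 = 0≢1 (begin
    0#            ≡⟨ zeroˡ x ⟨
    0# * x        ≡⟨ cong (_* x) x⁻¹≡0 ⟨
    x ⁻¹ * x      ≡⟨ ⁻¹-inverseˡ x≢0 ⟩
    1#            ∎)
    where open ≡-Reasoning

  ⁻¹-unique : ∀ {x y} → x * y ≡ 1# → x ⁻¹ ≡ y
  ⁻¹-unique {x} {y} xy≡1 = *-cancelˡ x≢0 (trans (inverse x x≢0) (sym xy≡1))
    where
    x≢0 : x ≢ 0#
    x≢0 x≡0 = 0≢1 (trans (sym (zeroˡ y)) (trans (cong (_* y) (sym x≡0)) xy≡1))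

  *-⁻¹-cancelʳ : ∀ {x} y → x ≢ 0# → (y * x ⁻¹) * x ≡ y
  *-⁻¹-cancelʳ {x} y x≢0 =
    trans (*-assoc _ _ _) (trans (cong (y *_) (⁻¹-inverseˡ x≢0)) (*-identityʳ y))

  /-intro : ∀ {x y z} → y ≢ 0# → x ≡ z * y → x / y ≡ z
  /-intro {x} {y} {z} y≢0 x≡zy = begin
    x * y ⁻¹            ≡⟨ cong (_* y ⁻¹) x≡zy ⟩
    (z * y) * y ⁻¹      ≡⟨ *-assoc _ _ _ ⟩
    z * (y * y ⁻¹)      ≡⟨ cong (z *_) (inverse y y≢0) ⟩
    z * 1#              ≡⟨ *-identityʳ z ⟩
    z                   ∎
    where open ≡-Reasoning

  ⁻¹≡/ : ∀ {x n y} → y ≢ 0# → x * n ≡ y → x ⁻¹ ≡ n / y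
  ⁻¹≡/ {x} {n} {y} y≢0 xn≡y = ⁻¹-unique (begin
    x * (n * y ⁻¹)      ≡⟨ *-assoc x n _ ⟨
    (x * n) * y ⁻¹      ≡⟨ cong (_* y ⁻¹) xn≡y ⟩
    y * y ⁻¹            ≡⟨ inverse y y≢0 ⟩
    1#                  ∎)
    where open ≡-Reasoning

  ^-distribˡ-+-* : ∀ x m n → x ^ (m ℕ.+ n) ≡ x ^ m * x ^ n
  ^-distribˡ-+-* x zero    n = sym (*-identityˡ _)
  ^-distribˡ-+-* x (suc m) n = trans (cong (x *_) (^-distribˡ-+-* x m n)) (sym (*-assoc _ _ _))

  ^-*-assoc : ∀ x m n → (x ^ m) ^ n ≡ x ^ (m ℕ.* n)
  ^-*-assoc x m zero    = cong (x ^_) (sym (ℕ.*-zeroʳ m))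
  ^-*-assoc x m (suc n) = begin
    x ^ m * (x ^ m) ^ n        ≡⟨ cong (x ^ m *_) (^-*-assoc x m n) ⟩
    x ^ m * x ^ (m ℕ.* n)      ≡⟨ ^-distribˡ-+-* x m (m ℕ.* n) ⟨
    x ^ (m ℕ.+ m ℕ.* n)        ≡⟨ cong (x ^_) (ℕ.*-suc m n) ⟨
    x ^ (m ℕ.* suc n)          ∎
    where open ≡-Reasoning

  ^-comm : ∀ x m n → (x ^ m) ^ n ≡ (x ^ n) ^ m
  ^-comm x m n = trans (^-*-assoc x m n) (trans (cong (x ^_) (ℕ.*-comm m n)) (sym (^-*-assoc x n m)))

  ^-distribʳ-* : ∀ x y n → (x * y) ^ n ≡ x ^ n * y ^ n
  ^-distribʳ-* x y zero    = sym (*-identityˡ 1#)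
  ^-distribʳ-* x y (suc n) = trans (cong ((x * y) *_) (^-distribʳ-* x y n))
    (solve 4 (λ x y a b → (x :* y) :* (a :* b) := (x :* a) :* (y :* b)) refl x y (x ^ n) (y ^ n))

  ^-zeroˡ : ∀ n → 1# ^ n ≡ 1#
  ^-zeroˡ zero    = refl
  ^-zeroˡ (suc n) = trans (*-identityˡ _) (^-zeroˡ n)

  1ⁿ*x≡x : ∀ n x → 1# ^ n * x ≡ x
  1ⁿ*x≡x n x = trans (cong (_* x) (^-zeroˡ n)) (*-identityˡ x)

  ⁻¹-^ : ∀ {x} n → x ≢ 0# → (x ^ n) ⁻¹ ≡ (x ⁻¹) ^ n
  ⁻¹-^ {x} n x≢0 = ⁻¹-unique (begin
    x ^ n * (x ⁻¹) ^ n     ≡⟨ ^-distribʳ-* x (x ⁻¹) n ⟨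
    (x * x ⁻¹) ^ n         ≡⟨ cong (_^ n) (inverse x x≢0) ⟩
    1# ^ n                 ≡⟨ ^-zeroˡ n ⟩
    1#                     ∎)
    where open ≡-Reasoning

  ^-ratio : ∀ {u c d} n → d ≢ 0# → u ^ n ≡ c * d ^ n → (u * d ⁻¹) ^ n ≡ c
  ^-ratio {u} {c} {d} n d≢0 uⁿ≡cdⁿ = begin
    (u * d ⁻¹) ^ n             ≡⟨ ^-distribʳ-* u (d ⁻¹) n ⟩
    u ^ n * (d ⁻¹) ^ n         ≡⟨ cong₂ _*_ uⁿ≡cdⁿ (sym (⁻¹-^ n d≢0)) ⟩
    (c * d ^ n) * (d ^ n) ⁻¹   ≡⟨ *-assoc c _ _ ⟩
    c * (d ^ n * (d ^ n) ⁻¹)   ≡⟨ cong (c *_) (inverse _ (x^n≢0 n d≢0)) ⟩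
    c * 1#                     ≡⟨ *-identityʳ c ⟩
    c                          ∎
    where open ≡-Reasoning

  ⁻¹^-cancelˡ : ∀ {u} n x → u ≢ 0# → (u ⁻¹) ^ n * (u ^ n * x) ≡ x
  ⁻¹^-cancelˡ {u} n x u≢0 = begin
    (u ⁻¹) ^ n * (u ^ n * x)     ≡⟨ *-assoc _ _ _ ⟨
    ((u ⁻¹) ^ n * u ^ n) * x     ≡⟨ cong (_* x) (^-distribʳ-* (u ⁻¹) u n) ⟨
    (u ⁻¹ * u) ^ n * x           ≡⟨ cong (λ t → t ^ n * x) (⁻¹-inverseˡ u≢0) ⟩
    1# ^ n * x                   ≡⟨ 1ⁿ*x≡x n x ⟩
    x                            ∎
    where open ≡-Reasoning

  IsPrimitiveRoot : ℕ → Carrier → Set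
  IsPrimitiveRoot k ζ = ζ ^ k ≡ 1# × (∀ d → 0 ℕ.< d → d ℕ.< k → ζ ^ d ≢ 1#)

  -1≢0 : - 1# ≢ 0#
  -1≢0 = -x≢0 1≢0

  -1≢1 : ι 2 ≢ 0# → - 1# ≢ 1#
  -1≢1 2≢0 -1≡1 = 2≢0 (begin
    ι 2            ≡⟨ solve 0 (# 2 := # 1 :+ # 1) refl ⟩
    1# + 1#        ≡⟨ cong (1# +_) -1≡1 ⟨
    1# + (- 1#)    ≡⟨ -‿inverseʳ 1# ⟩
    0#             ∎)
    where open ≡-Reasoning

  -1²≡1 : (- 1#) ^ 2 ≡ 1#
  -1²≡1 = solve 0 ((:- # 1) :^ 2 := # 1) refl

  -1^[1+2t]≡-1 : ∀ t → (- 1#) ^ suc (2 ℕ.* t) ≡ - 1#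
  -1^[1+2t]≡-1 t = begin
    (- 1#) * (- 1#) ^ (2 ℕ.* t)    ≡⟨ cong ((- 1#) *_) (^-*-assoc (- 1#) 2 t) ⟨
    (- 1#) * ((- 1#) ^ 2) ^ t      ≡⟨ cong (λ x → (- 1#) * x ^ t) -1²≡1 ⟩
    (- 1#) * 1# ^ t                ≡⟨ cong ((- 1#) *_) (^-zeroˡ t) ⟩
    (- 1#) * 1#                    ≡⟨ *-identityʳ _ ⟩
    - 1#                           ∎
    where open ≡-Reasoning

  order-two : ∀ {ζ} → ζ ^ 2 ≡ 1# → ζ ≢ 1# → IsPrimitiveRoot 2 ζ
  order-two ζ²≡1 ζ≢1 = ζ²≡1 , λ where
    1 _ _ ζ¹≡1 → ζ≢1 (trans (sym (*-identityʳ _)) ζ¹≡1)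
    (suc (suc _)) _ (s≤s (s≤s ()))

  order-three : ∀ {ζ} → ζ ^ 3 ≡ 1# → ζ ≢ 1# → IsPrimitiveRoot 3 ζ
  order-three {ζ} ζ³≡1 ζ≢1 = ζ³≡1 , λ where
    1 _ _ ζ¹≡1 → ζ≢1 (trans (sym (*-identityʳ _)) ζ¹≡1)
    2 _ _ ζ²≡1 → ζ≢1 (trans (sym (*-identityʳ ζ)) (trans (cong (ζ *_) (sym ζ²≡1)) ζ³≡1))
    (suc (suc (suc _))) _ (s≤s (s≤s (s≤s ())))

  order-four : ∀ {ζ} → ζ ^ 4 ≡ 1# → ζ ^ 2 ≢ 1# → IsPrimitiveRoot 4 ζ
  order-four {ζ} ζ⁴≡1 ζ²≢1 = ζ⁴≡1 , λ where
    1 _ _ ζ¹≡1 → ζ²≢1 (trans (cong (ζ *_) ζ¹≡1) ζ¹≡1)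
    2 _ _ ζ²≡1 → ζ²≢1 ζ²≡1
    3 _ _ ζ³≡1 → let ζ¹≡1 = trans (cong (ζ *_) (sym ζ³≡1)) ζ⁴≡1 in ζ²≢1 (trans (cong (ζ *_) ζ¹≡1) ζ¹≡1)
    (suc (suc (suc (suc _)))) _ (s≤s (s≤s (s≤s (s≤s ()))))

  private
    no-gap : ∀ {k ζ} → IsPrimitiveRoot k ζ → ∀ (i j : Fin k) → toℕ i ℕ.< toℕ j → ζ ^ toℕ i ≢ ζ ^ toℕ j
    no-gap {suc k} {ζ} (ζᵏ≡1 , minimal) i j i<j ζⁱ≡ζʲ = minimal (toℕ j ∸ toℕ i) (ℕ.m<n⇒0<n∸m i<j)
      (ℕ.≤-<-trans (ℕ.m∸n≤m (toℕ j) (toℕ i)) (Fin.toℕ<n j))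
      (*-cancelˡ (x^n≢0 (toℕ i) (xⁿ≡1⇒x≢0 (suc k) (s≤s z≤n) ζᵏ≡1)) (begin
        ζ ^ toℕ i * ζ ^ (toℕ j ∸ toℕ i)    ≡⟨ ^-distribˡ-+-* ζ (toℕ i) _ ⟨
        ζ ^ (toℕ i ℕ.+ (toℕ j ∸ toℕ i))    ≡⟨ cong (ζ ^_) (ℕ.m+[n∸m]≡n (ℕ.<⇒≤ i<j)) ⟩
        ζ ^ toℕ j                          ≡⟨ ζⁱ≡ζʲ ⟨
        ζ ^ toℕ i                          ≡⟨ *-identityʳ _ ⟨
        ζ ^ toℕ i * 1#                     ∎))
      where open ≡-Reasoning

  ^-injective : ∀ {k ζ} → IsPrimitiveRoot k ζ → ∀ (i j : Fin k) → ζ ^ toℕ i ≡ ζ ^ toℕ j → i ≡ j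
  ^-injective prim i j ζⁱ≡ζʲ with ℕ.<-cmp (toℕ i) (toℕ j)
  ... | tri< i<j _ _ = ⊥-elim (no-gap prim i j i<j ζⁱ≡ζʲ)
  ... | tri≈ _ i≡j _ = Fin.toℕ-injective i≡j
  ... | tri> _ _ j<i = ⊥-elim (no-gap prim j i j<i (sym ζⁱ≡ζʲ))

module DecidableFieldProperties (F : Field) (_≟_ : DecidableEquality (Field.Carrier F)) where

  open FieldProperties F

  x^n≡0⇒x≡0 : ∀ {x} n → x ^ n ≡ 0# → x ≡ 0#
  x^n≡0⇒x≡0 {x} n xⁿ≡0 with x ≟ 0#
  ... | yes x≡0 = x≡0
  ... | no  x≢0 = ⊥-elim (x^n≢0 n x≢0 xⁿ≡0)

module FieldHomProperties {F K : Field} (h : FieldHom F K) where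

  private
    module F = FieldProperties F
    module K = FieldProperties K
  open FieldHom h

  map-0 : map F.0# ≡ K.0#
  map-0 = sym (begin
    K.0#                       ≡⟨ K.-‿inverseʳ m ⟨
    m K.- m                    ≡⟨ cong (K._- m) m≡m+m ⟩
    (m K.+ m) K.- m            ≡⟨ K.+-assoc m m (K.- m) ⟩
    m K.+ (m K.- m)            ≡⟨ cong (m K.+_) (K.-‿inverseʳ m) ⟩
    m K.+ K.0#                 ≡⟨ K.+-identityʳ m ⟩
    m                          ∎)
    where
    open ≡-Reasoning
    m = map F.0#
    m≡m+m : m ≡ m K.+ m
    m≡m+m = trans (cong map (sym (F.+-identityʳ F.0#))) (map-+ F.0# F.0#)

  map-^ : ∀ x n → map (x F.^ n) ≡ map x K.^ n
  map-^ x zero    = map-1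
  map-^ x (suc n) = trans (map-* x (x F.^ n)) (cong (map x K.*_) (map-^ x n))

  map-≢0 : ∀ {x} → x ≢ F.0# → map x ≢ K.0#
  map-≢0 {x} x≢0 mx≡0 = K.0≢1 (begin
    K.0#                       ≡⟨ K.zeroˡ _ ⟨
    K.0# K.* map (x F.⁻¹)      ≡⟨ cong (K._* map (x F.⁻¹)) mx≡0 ⟨
    map x K.* map (x F.⁻¹)     ≡⟨ map-* x (x F.⁻¹) ⟨
    map (x F.* x F.⁻¹)         ≡⟨ cong map (F.inverse x x≢0) ⟩
    map F.1#                   ≡⟨ map-1 ⟩
    K.1#                       ∎)
    where open ≡-Reasoning

module Polynomials (F : Field) where

  open FieldProperties F

  -- Polynomials are coefficient lists, constant term first.
  eval : List Carrier → Carrier → Carrier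
  eval []      y = 0#
  eval (a ∷ p) y = a + y * eval p y

  AllZero : List Carrier → Set
  AllZero = All (_≡ 0#)

  quotient : List Carrier → Carrier → List Carrier
  quotient []          r = []
  quotient (a ∷ [])    r = []
  quotient (a ∷ b ∷ p) r = eval (b ∷ p) r ∷ quotient (b ∷ p) r

  eval-quotient : ∀ p y r → eval p y ≡ (y - r) * eval (quotient p r) y + eval p r
  eval-quotient []          y r = solve 2 (λ y r → # 0 := (y :- r) :* # 0 :+ # 0) refl y r
  eval-quotient (a ∷ [])    y r =
    solve 3 (λ a y r → a :+ y :* # 0 := (y :- r) :* # 0 :+ (a :+ r :* # 0)) refl a y r
  eval-quotient (a ∷ b ∷ p) y r = begin
    a + y * eval (b ∷ p) y                          ≡⟨ cong (λ t → a + y * t) (eval-quotient (b ∷ p) y r) ⟩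
    a + y * ((y - r) * Q + E)                       ≡⟨ solve 5 (λ a y r Q E →
                                                         a :+ y :* ((y :- r) :* Q :+ E)
                                                      := (y :- r) :* (E :+ y :* Q) :+ (a :+ r :* E)) refl a y r Q E ⟩
    (y - r) * (E + y * Q) + (a + r * E)             ∎
    where
    open ≡-Reasoning
    Q = eval (quotient (b ∷ p) r) y
    E = eval (b ∷ p) r

  length-quotient : ∀ p r → length (quotient p r) ≡ length p ∸ 1
  length-quotient []          r = refl
  length-quotient (a ∷ [])    r = refl
  length-quotient (a ∷ b ∷ p) r = cong suc (length-quotient (b ∷ p) r)

  AllZero-quotient : ∀ p r → eval p r ≡ 0# → AllZero (quotient p r) → AllZero p
  AllZero-quotient []          r _   _                 = []
  AllZero-quotient (a ∷ [])    r p[r]≡0 _            =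
    trans (sym (trans (cong (a +_) (zeroʳ r)) (+-identityʳ a))) p[r]≡0 ∷ []
  AllZero-quotient (a ∷ b ∷ p) r p[r]≡0 (q₀≡0 ∷ q≡0) = a≡0 ∷ AllZero-quotient (b ∷ p) r q₀≡0 q≡0
    where
    a≡0 : a ≡ 0#
    a≡0 = trans (sym (trans (cong (λ t → a + r * t) q₀≡0) (trans (cong (a +_) (zeroʳ r)) (+-identityʳ a)))) p[r]≡0

  roots-bound : ∀ rs p → Unique rs → All (λ r → eval p r ≡ 0#) rs → length p ℕ.≤ length rs → AllZero p
  roots-bound []       []      _           _              _  = []
  roots-bound (r ∷ rs) p       (r∉ ∷ uniq) (p[r]≡0 ∷ roots) ∣p∣≤ =
    AllZero-quotient p r p[r]≡0 (roots-bound rs (quotient p r) uniq (All.zipWith root-of-quotient (r∉ , roots)) ∣q∣≤)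
    where
    root-of-quotient : ∀ {x} → r ≢ x × eval p x ≡ 0# → eval (quotient p r) x ≡ 0#
    root-of-quotient {x} (r≢x , p[x]≡0) = x*y≡0⇒y≡0 (λ x-r≡0 → r≢x (sym (x-y≡0⇒x≡y x-r≡0))) (begin
      (x - r) * eval (quotient p r) x                 ≡⟨ +-identityʳ _ ⟨
      (x - r) * eval (quotient p r) x + 0#            ≡⟨ cong ((x - r) * eval (quotient p r) x +_) p[r]≡0 ⟨
      (x - r) * eval (quotient p r) x + eval p r      ≡⟨ eval-quotient p x r ⟨
      eval p x                                        ≡⟨ p[x]≡0 ⟩
      0#                                              ∎)
      where open ≡-Reasoning
    ∣q∣≤ : length (quotient p r) ℕ.≤ length rs
    ∣q∣≤ = subst (ℕ._≤ length rs) (sym (length-quotient p r)) (ℕ.∸-monoˡ-≤ 1 ∣p∣≤)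

  shift : ℕ → List Carrier → List Carrier
  shift n p = replicate n 0# ++ p

  eval-shift : ∀ n p y → eval (shift n p) y ≡ y ^ n * eval p y
  eval-shift zero    p y = sym (*-identityˡ _)
  eval-shift (suc n) p y = trans (cong (λ t → 0# + y * t) (eval-shift n p y))
    (solve 3 (λ y a b → # 0 :+ y :* (a :* b) := (y :* a) :* b) refl y (y ^ n) (eval p y))

  AllZero-shift : ∀ n p → AllZero (shift n p) → AllZero p
  AllZero-shift zero    p z       = z
  AllZero-shift (suc n) p (_ ∷ z) = AllZero-shift n p z

  length-shift : ∀ n p → length (shift n p) ≡ n ℕ.+ length p
  length-shift n p = trans (List.length-++ (replicate n 0#)) (cong (ℕ._+ length p) (List.length-replicate n))

  binomial : ℕ → Carrier → List Carrier
  binomial n c = (- c) ∷ shift n (1# ∷ [])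

  eval-binomial : ∀ n c y → eval (binomial n c) y ≡ (y ^ suc n) - c
  eval-binomial n c y = trans (cong (λ t → - c + y * t) (eval-shift n (1# ∷ []) y))
    (solve 3 (λ c y Y → :- c :+ y :* (Y :* (# 1 :+ y :* # 0)) := y :* Y :- c) refl c y (y ^ n))

  binomial-≢0 : ∀ n c → ¬ AllZero (binomial n c)
  binomial-≢0 n c (_ ∷ z) with AllZero-shift n (1# ∷ []) z
  ... | 1≡0 ∷ [] = 1≢0 1≡0

  -- Σᵢ cⁿ⁻ⁱ y^(i(1+k)) (i = 0 … n): the cofactor of y^(1+k) - c in y^((1+k)(1+n)) - c^(1+n)
  geometric : ℕ → Carrier → ℕ → List Carrier
  geometric k c zero    = 1# ∷ []
  geometric k c (suc n) = c ^ suc n ∷ shift k (geometric k c n)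

  length-geometric : ∀ k c n → length (geometric k c n) ≡ suc (n ℕ.* suc k)
  length-geometric k c zero    = refl
  length-geometric k c (suc n) = cong suc (begin
    length (shift k (geometric k c n))   ≡⟨ length-shift k _ ⟩
    k ℕ.+ length (geometric k c n)       ≡⟨ cong (k ℕ.+_) (length-geometric k c n) ⟩
    k ℕ.+ suc (n ℕ.* suc k)              ≡⟨ ℕ.+-suc k _ ⟩
    suc (k ℕ.+ n ℕ.* suc k)              ∎)
    where open ≡-Reasoning

  geometric-≢0 : ∀ k c n → ¬ AllZero (geometric k c n)
  geometric-≢0 k c zero    (1≡0 ∷ []) = 1≢0 1≡0
  geometric-≢0 k c (suc n) (_ ∷ z)    = geometric-≢0 k c n (AllZero-shift k _ z)

  eval-geometric : ∀ k c n y →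
    ((y ^ suc k) - c) * eval (geometric k c n) y ≡ (y ^ (suc k ℕ.* suc n)) - (c ^ suc n)
  eval-geometric k c zero    y = begin
    ((y ^ suc k) - c) * (1# + y * 0#)    ≡⟨ solve 3 (λ y Y c → (Y :- c) :* (# 1 :+ y :* # 0) := Y :- c :* # 1) refl y (y ^ suc k) c ⟩
    (y ^ suc k) - (c * 1#)               ≡⟨ cong (λ t → (y ^ t) - (c * 1#)) (ℕ.*-identityʳ (suc k)) ⟨
    (y ^ (suc k ℕ.* 1)) - (c * 1#)       ∎
    where open ≡-Reasoning
  eval-geometric k c (suc n) y = begin
    (Y - c) * (c ^ suc n + y * eval (shift k (geometric k c n)) y)
      ≡⟨ cong (λ t → (Y - c) * (c ^ suc n + y * t)) (eval-shift k _ y) ⟩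
    (Y - c) * (c * C + y * (y ^ k * G))
      ≡⟨ solve 5 (λ y Yk c C G → (y :* Yk :- c) :* (c :* C :+ y :* (Yk :* G))
                               := (y :* Yk) :* ((y :* Yk :- c) :* G) :+ (:- (c :* (c :* C)) :+ (y :* Yk) :* (c :* C)))
               refl y (y ^ k) c (c ^ n) G ⟩
    Y * ((Y - c) * G) + (- (c * C′) + Y * C′)
      ≡⟨ cong (λ t → Y * t + (- (c * C′) + Y * C′)) (eval-geometric k c n y) ⟩
    Y * ((y ^ (suc k ℕ.* suc n)) - C′) + (- (c * C′) + Y * C′)
      ≡⟨ solve 4 (λ Y Z C c → Y :* (Z :- C) :+ (:- (c :* C) :+ Y :* C) := Y :* Z :- c :* C) refl Y (y ^ (suc k ℕ.* suc n)) C′ c ⟩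
    (Y * y ^ (suc k ℕ.* suc n)) - (c * C′)
      ≡⟨ cong (_- (c * C′)) (^-distribˡ-+-* y (suc k) (suc k ℕ.* suc n)) ⟨
    (y ^ (suc k ℕ.+ suc k ℕ.* suc n)) - (c * C′)
      ≡⟨ cong (λ t → (y ^ t) - (c * C′)) (ℕ.*-suc (suc k) (suc n)) ⟨
    (y ^ (suc k ℕ.* suc (suc n))) - (c * C′)
      ∎
    where
    open ≡-Reasoning
    Y = y ^ suc k
    C = c ^ n
    C′ = c ^ suc n
    G = eval (geometric k c n) y

module RootsOfUnity (F : Field) (_≟_ : DecidableEquality (Field.Carrier F)) where

  open FieldProperties F
  open Polynomials F

  -- Otherwise y^k - 1 would have the k + 1 distinct roots x, ζ⁰, …, ζ^(k-1).
  roots-of-unity : ∀ {k ζ} → 0 ℕ.< k → IsPrimitiveRoot k ζ → ∀ {x} → x ^ k ≡ 1# →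
                   Σ[ j ∈ Fin k ] x ≡ ζ ^ toℕ j
  roots-of-unity {suc k} {ζ} _ prim@(ζᵏ≡1 , _) {x} xᵏ≡1 with Fin.any? (λ j → x ≟ (ζ ^ toℕ j))
  ... | yes found = found
  ... | no  x∉    = ⊥-elim (binomial-≢0 k 1# (roots-bound rs (binomial k 1#) unique roots ∣p∣≤∣rs∣))
    where
    powers = tabulate (λ (j : Fin (suc k)) → ζ ^ toℕ j)
    rs = x ∷ powers
    unique : Unique rs
    unique = All.tabulate⁺ (λ j x≡ζʲ → x∉ (j , x≡ζʲ)) ∷ Unique.tabulate⁺ (λ {i} {j} → ^-injective prim i j)
    is-root : ∀ {y} → y ^ suc k ≡ 1# → eval (binomial k 1#) y ≡ 0#
    is-root {y} yᵏ≡1 = trans (eval-binomial k 1# y) (trans (cong (_- 1#) yᵏ≡1) (-‿inverseʳ 1#))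
    roots : All (λ r → eval (binomial k 1#) r ≡ 0#) rs
    roots = is-root xᵏ≡1 ∷ All.tabulate⁺ (λ j → is-root (begin
      (ζ ^ toℕ j) ^ suc k    ≡⟨ ^-comm ζ (toℕ j) (suc k) ⟩
      (ζ ^ suc k) ^ toℕ j    ≡⟨ cong (_^ toℕ j) ζᵏ≡1 ⟩
      1# ^ toℕ j             ≡⟨ ^-zeroˡ (toℕ j) ⟩
      1#                     ∎))
      where open ≡-Reasoning
    ∣p∣≤∣rs∣ : length (binomial k 1#) ℕ.≤ length rs
    ∣p∣≤∣rs∣ = ℕ.≤-reflexive (cong suc (trans (length-shift k (1# ∷ [])) (trans (ℕ.+-comm k 1) (sym (List.length-tabulate (λ (j : Fin (suc k)) → ζ ^ toℕ j))))))

same-members⇒↭ : ∀ {A : Set} {xs ys : List A} → Unique xs → Unique ys → (∀ {x} → x ∈ xs ⇔ x ∈ ys) → xs ↭ ys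
same-members⇒↭ xs! ys! xs≈ys = ∼bag⇒↭ (unique∧set⇒bag xs! ys! xs≈ys)

module FiniteFieldProperties (𝔽 : FiniteField) where

  open FiniteField 𝔽 using (field'; size; enum)
  open FieldProperties field'
  open Polynomials field'
  open Inverse enum using (to; from; strictlyInverseˡ; strictlyInverseʳ)

  to-injective : ∀ {x y} → to x ≡ to y → x ≡ y
  to-injective {x} {y} eq = trans (sym (strictlyInverseʳ x)) (trans (cong from eq) (strictlyInverseʳ y))

  _≟_ : DecidableEquality Carrier
  x ≟ y = map′ to-injective (cong to) (to x Fin.≟ to y)

  open RootsOfUnity field' _≟_ public

  elements : List Carrier
  elements = List.map from (allFin size)

  ∈-elements : ∀ x → x ∈ elements
  ∈-elements x = subst (_∈ elements) (strictlyInverseʳ x) (∈.∈-map⁺ from (∈.∈-allFin (to x)))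

  elements-unique : Unique elements
  elements-unique = Unique.map⁺ from-injective (Unique.allFin⁺ size)
    where
    from-injective : ∀ {i j} → from i ≡ from j → i ≡ j
    from-injective {i} {j} eq = trans (sym (strictlyInverseˡ i)) (trans (cong to eq) (strictlyInverseˡ j))

  units : List Carrier
  units = filter (λ x → ¬? (x ≟ 0#)) elements

  #units : ℕ
  #units = length units

  ∈-units : ∀ {x} → x ≢ 0# → x ∈ units
  ∈-units {x} x≢0 = ∈.∈-filter⁺ (λ x → ¬? (x ≟ 0#)) (∈-elements x) x≢0

  units-≢0 : All (_≢ 0#) units
  units-≢0 = All.all-filter (λ x → ¬? (x ≟ 0#)) elements

  units-unique : Unique units
  units-unique = Unique.filter⁺ (λ x → ¬? (x ≟ 0#)) elements-unique

  suc-#units : suc #units ≡ size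
  suc-#units = begin
    length (0# ∷ units)   ≡⟨ ↭-length elements↭0∷units ⟨
    length elements       ≡⟨ List.length-map from (allFin size) ⟩
    length (allFin size)  ≡⟨ List.length-tabulate (λ i → i) ⟩
    size                  ∎
    where
    open ≡-Reasoning
    0∉units : All (0# ≢_) units
    0∉units = All.map (λ x≢0 0≡x → x≢0 (sym 0≡x)) units-≢0
    elements↭0∷units : elements ↭ 0# ∷ units
    elements↭0∷units = same-members⇒↭ elements-unique (0∉units ∷ units-unique) (mk⇔ to∷ λ _ → ∈-elements _)
      where
      to∷ : ∀ {x} → x ∈ elements → x ∈ 0# ∷ units
      to∷ {x} _ with x ≟ 0#
      ... | yes x≡0 = here x≡0
      ... | no  x≢0 = there (∈-units x≢0)

  1≤#units : 1 ℕ.≤ #units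
  1≤#units with units | ∈-units 1≢0
  ... | _ ∷ _ | _ = s≤s z≤n

  -- Fermat's little theorem

  ∏ : List Carrier → Carrier
  ∏ = foldr _*_ 1#

  ∏-↭ : ∀ {xs ys} → xs ↭ ys → ∏ xs ≡ ∏ ys
  ∏-↭ xs↭ys = PermutationSetoid.foldr-commMonoid (setoid Carrier)
    (CommutativeRing.*-isCommutativeMonoid commutativeRing) (↭⇒↭ₛ xs↭ys)

  ∏-map-* : ∀ a xs → ∏ (List.map (a *_) xs) ≡ a ^ length xs * ∏ xs
  ∏-map-* a []       = sym (*-identityʳ 1#)
  ∏-map-* a (x ∷ xs) = trans (cong (a * x *_) (∏-map-* a xs))
    (solve 4 (λ a x b c → (a :* x) :* (b :* c) := (a :* b) :* (x :* c)) refl a x (a ^ length xs) (∏ xs))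

  ∏-≢0 : ∀ {xs} → All (_≢ 0#) xs → ∏ xs ≢ 0#
  ∏-≢0 []             = 1≢0
  ∏-≢0 (x≢0 ∷ xs≢0)  = x*y≢0 x≢0 (∏-≢0 xs≢0)

  -- Multiplication by a unit permutes the units.
  fermat : ∀ {a} → a ≢ 0# → a ^ #units ≡ 1#
  fermat {a} a≢0 = *-cancelˡ (∏-≢0 units-≢0) (begin
    ∏ units * a ^ #units        ≡⟨ *-comm _ _ ⟩
    a ^ #units * ∏ units        ≡⟨ ∏-map-* a units ⟨
    ∏ (List.map (a *_) units)   ≡⟨ ∏-↭ units↭a*units ⟨
    ∏ units                     ≡⟨ *-identityʳ _ ⟨
    ∏ units * 1#                ∎)
    where
    open ≡-Reasoning
    units↭a*units : units ↭ List.map (a *_) units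
    units↭a*units = same-members⇒↭ units-unique (Unique.map⁺ (*-cancelˡ a≢0) units-unique) (mk⇔ into onto)
      where
      into : ∀ {x} → x ∈ units → x ∈ List.map (a *_) units
      into {x} x∈ = subst (_∈ List.map (a *_) units) a[a⁻¹x]≡x
        (∈.∈-map⁺ (a *_) (∈-units (x*y≢0 (x⁻¹≢0 a≢0) (All.lookup units-≢0 x∈))))
        where
        a[a⁻¹x]≡x : a * (a ⁻¹ * x) ≡ x
        a[a⁻¹x]≡x = trans (sym (*-assoc _ _ _)) (trans (cong (_* x) (inverse a a≢0)) (*-identityˡ x))
      onto : ∀ {x} → x ∈ List.map (a *_) units → x ∈ units
      onto x∈ with ∈.∈-map⁻ (a *_) x∈
      ... | y , y∈ , refl = ∈-units (x*y≢0 a≢0 (All.lookup units-≢0 y∈))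

  ^-#units≡1 : ∀ {a} k m → k ℕ.* m ≡ #units → a ≢ 0# → (a ^ k) ^ m ≡ 1#
  ^-#units≡1 {a} k m km≡N a≢0 = trans (^-*-assoc a k m) (trans (cong (a ^_) km≡N) (fermat a≢0))

  #units-even : ι 2 ≢ 0# → Σ[ m ∈ ℕ ] 2 ℕ.* m ≡ #units
  #units-even 2≢0 = parity (#units ℕ.% 2) (m≡m%n+[m/n]*n #units 2) (m%n<n #units 2)
    where
    parity : ∀ r → #units ≡ r ℕ.+ (#units ℕ./ 2) ℕ.* 2 → r ℕ.< 2 → Σ[ m ∈ ℕ ] 2 ℕ.* m ≡ #units
    parity 0             N≡ _ = #units ℕ./ 2 , trans (ℕ.*-comm 2 (#units ℕ./ 2)) (sym N≡)
    parity 1             N≡ _ = ⊥-elim (-1≢1 2≢0 (begin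
      - 1#                                ≡⟨ -1^[1+2t]≡-1 (#units ℕ./ 2) ⟨
      (- 1#) ^ suc (2 ℕ.* (#units ℕ./ 2))   ≡⟨ cong (λ n → (- 1#) ^ suc n) (ℕ.*-comm 2 (#units ℕ./ 2)) ⟩
      (- 1#) ^ suc ((#units ℕ./ 2) ℕ.* 2)   ≡⟨ cong ((- 1#) ^_) N≡ ⟨
      (- 1#) ^ #units                     ≡⟨ fermat -1≢0 ⟩
      1#                                  ∎))
      where open ≡-Reasoning
    parity (suc (suc _)) _  (s≤s (s≤s ()))

  non-residue⇒∄root : ∀ k m → k ℕ.* m ≡ #units → ∀ {c} → c ≢ 0# → c ^ m ≢ 1# → ∀ x → x ^ k ≢ c
  non-residue⇒∄root zero    m 0≡N  _   _    _ _    = ℕ.<⇒≢ 1≤#units 0≡N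
  non-residue⇒∄root (suc k) m km≡N c≢0 cᵐ≢1 x xᵏ≡c =
    cᵐ≢1 (trans (cong (_^ m) (sym xᵏ≡c)) (^-#units≡1 (suc k) m km≡N x≢0))
    where
    x≢0 : x ≢ 0#
    x≢0 = x^n≢0⇒x≢0 (suc k) (s≤s z≤n) (subst (_≢ 0#) (sym xᵏ≡c) c≢0)


  -- If k m = #units, the k-th powers are the roots of y^m - 1: otherwise every unit
  -- would be a root of the cofactor of y^k - c in y^(km) - c^m, which has too small a degree.
  kth-root : ∀ k m → k ℕ.* m ≡ #units → ∀ {c} → c ≢ 0# → c ^ m ≡ 1# → Σ[ r ∈ Carrier ] r ^ k ≡ c
  kth-root zero    m       0≡N  _ _ = ⊥-elim (ℕ.<⇒≢ 1≤#units 0≡N)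
  kth-root (suc k) zero    k0≡N _ _ = ⊥-elim (ℕ.<⇒≢ 1≤#units (trans (sym (ℕ.*-zeroʳ (suc k))) k0≡N))
  kth-root (suc k) (suc n) km≡N {c} c≢0 cᵐ≡1 with any? (λ y → (y ^ suc k) ≟ c) units
  ... | yes found = satisfied found
  ... | no  none  = ⊥-elim (geometric-≢0 k c n (roots-bound units (geometric k c n) units-unique roots ∣p∣≤N))
    where
    root-of-cofactor : ∀ {y} → y ^ suc k ≢ c → y ≢ 0# → eval (geometric k c n) y ≡ 0#
    root-of-cofactor {y} yᵏ≢c y≢0 = x*y≡0⇒y≡0 (λ yᵏ-c≡0 → yᵏ≢c (x-y≡0⇒x≡y yᵏ-c≡0)) (begin
      ((y ^ suc k) - c) * eval (geometric k c n) y     ≡⟨ eval-geometric k c n y ⟩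
      (y ^ (suc k ℕ.* suc n)) - (c ^ suc n)            ≡⟨ cong₂ _-_ (trans (cong (y ^_) km≡N) (fermat y≢0)) cᵐ≡1 ⟩
      1# - 1#                                          ≡⟨ -‿inverseʳ 1# ⟩
      0#                                               ∎)
      where open ≡-Reasoning
    roots : All (λ y → eval (geometric k c n) y ≡ 0#) units
    roots = All.zipWith (uncurry root-of-cofactor) (All.¬Any⇒All¬ units none , units-≢0)
    ∣p∣≤N : length (geometric k c n) ℕ.≤ #units
    ∣p∣≤N = begin
      length (geometric k c n)       ≡⟨ length-geometric k c n ⟩
      suc (n ℕ.* suc k)              ≤⟨ ℕ.m≤m+n _ k ⟩
      suc (n ℕ.* suc k) ℕ.+ k        ≡⟨ [1+k][1+n]≡1+n[1+k]+k k n ⟨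
      suc k ℕ.* suc n                ≡⟨ km≡N ⟩
      #units                         ∎
      where open ℕ.≤-Reasoning

  -- If k > 1 then y^m - 1, of degree m < #units, does not vanish on all units.
  non-residue : ∀ k m → 2 ℕ.≤ k → k ℕ.* m ≡ #units → Σ[ a ∈ Carrier ] a ≢ 0# × a ^ m ≢ 1#
  non-residue k zero    _   k0≡N = ⊥-elim (ℕ.<⇒≢ 1≤#units (trans (sym (ℕ.*-zeroʳ k)) k0≡N))
  non-residue k (suc n) 2≤k km≡N with any? (λ y → ¬? ((y ^ suc n) ≟ 1#)) units
  ... | yes found = let (a , a∈ , aᵐ≢1) = find found in a , All.lookup units-≢0 a∈ , aᵐ≢1
  ... | no  none  = ⊥-elim (binomial-≢0 n 1# (roots-bound units (binomial n 1#) units-unique roots ∣p∣≤N))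
    where
    roots : All (λ y → eval (binomial n 1#) y ≡ 0#) units
    roots = All.map (λ {y} ¬yᵐ≢1 → trans (eval-binomial n 1# y)
      (trans (cong (_- 1#) (decidable-stable ((y ^ suc n) ≟ 1#) ¬yᵐ≢1)) (-‿inverseʳ 1#)))
      (All.¬Any⇒All¬ units none)
    ∣p∣≤N : length (binomial n 1#) ℕ.≤ #units
    ∣p∣≤N = begin
      length (binomial n 1#)    ≡⟨ cong suc (length-shift n (1# ∷ [])) ⟩
      suc n ℕ.+ 1               ≤⟨ ℕ.+-monoʳ-≤ (suc n) (s≤s z≤n) ⟩
      suc n ℕ.+ suc n           ≡⟨ cong (suc n ℕ.+_) (ℕ.+-identityʳ (suc n)) ⟨
      2 ℕ.* suc n               ≤⟨ ℕ.*-monoˡ-≤ (suc n) 2≤k ⟩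
      k ℕ.* suc n               ≡⟨ km≡N ⟩
      #units                    ∎
      where open ℕ.≤-Reasoning

  -- (k t + 1)(k + 1) = k · #units + 1
  kth-root-of-coprime : ∀ k t → suc k ℕ.* t ℕ.+ 1 ≡ #units → ∀ {c} → c ≢ 0# → (c ^ (k ℕ.* t ℕ.+ 1)) ^ suc k ≡ c
  kth-root-of-coprime k t N≡ {c} c≢0 = begin
    (c ^ (k ℕ.* t ℕ.+ 1)) ^ suc k          ≡⟨ ^-*-assoc c (k ℕ.* t ℕ.+ 1) (suc k) ⟩
    c ^ ((k ℕ.* t ℕ.+ 1) ℕ.* suc k)        ≡⟨ cong (c ^_) ([kt+1][1+k]≡[[1+k]t+1]k+1 k t) ⟩
    c ^ ((suc k ℕ.* t ℕ.+ 1) ℕ.* k ℕ.+ 1)  ≡⟨ cong (λ n → c ^ (n ℕ.* k ℕ.+ 1)) N≡ ⟩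
    c ^ (#units ℕ.* k ℕ.+ 1)               ≡⟨ ^-distribˡ-+-* c (#units ℕ.* k) 1 ⟩
    c ^ (#units ℕ.* k) * c ^ 1             ≡⟨ cong₂ _*_ cᴺᵏ≡1 (*-identityʳ c) ⟩
    1# * c                                 ≡⟨ *-identityˡ c ⟩
    c                                      ∎
    where
    open ≡-Reasoning
    cᴺᵏ≡1 : c ^ (#units ℕ.* k) ≡ 1#
    cᴺᵏ≡1 = trans (sym (^-*-assoc c #units k)) (trans (cong (_^ k) (fermat c≢0)) (^-zeroˡ k))

  -- When k m = #units and g ^ m is a primitive k-th root of unity, the powers
  -- g ^ j (j < k) represent the classes of the units modulo k-th powers; the
  -- character x ↦ x ^ m tells them apart.
  module PowerClasses (k m : ℕ) (km≡N : k ℕ.* m ≡ #units) {g} (g≢0 : g ≢ 0#) (prim : IsPrimitiveRoot k (g ^ m)) where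

    private
      χ-kth-power : ∀ {s} x → s ≢ 0# → (s ^ k * x) ^ m ≡ x ^ m
      χ-kth-power {s} x s≢0 = begin
        (s ^ k * x) ^ m           ≡⟨ ^-distribʳ-* (s ^ k) x m ⟩
        (s ^ k) ^ m * x ^ m       ≡⟨ cong (_* x ^ m) (^-#units≡1 k m km≡N s≢0) ⟩
        1# * x ^ m                ≡⟨ *-identityˡ _ ⟩
        x ^ m                     ∎
        where open ≡-Reasoning

      0<k : 0 ℕ.< k
      0<k = ℕ.n≢0⇒n>0 (λ { refl → ℕ.<⇒≢ 1≤#units km≡N })

    classify : ∀ {c} → c ≢ 0# → Σ[ j ∈ Fin k ] Σ[ s ∈ Carrier ] s ≢ 0# × c ≡ s ^ k * g ^ toℕ j
    classify {c} c≢0 = j , s , x^n≢0⇒x≢0 k 0<k (subst (_≢ 0#) (sym sᵏ≡c′) c′≢0) , c≡sᵏgʲ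
      where
      open ≡-Reasoning
      cᵐ-root = roots-of-unity 0<k prim (^-#units≡1 m k (trans (ℕ.*-comm m k) km≡N) c≢0)
      j = proj₁ cᵐ-root
      gʲ = g ^ toℕ j
      gʲ≢0 : gʲ ≢ 0#
      gʲ≢0 = x^n≢0 (toℕ j) g≢0
      c′ = c * gʲ ⁻¹
      c′≢0 : c′ ≢ 0#
      c′≢0 = x*y≢0 c≢0 (x⁻¹≢0 gʲ≢0)
      c′ᵐ≡1 : c′ ^ m ≡ 1#
      c′ᵐ≡1 = begin
        (c * gʲ ⁻¹) ^ m          ≡⟨ ^-distribʳ-* c (gʲ ⁻¹) m ⟩
        c ^ m * (gʲ ⁻¹) ^ m      ≡⟨ cong (c ^ m *_) (⁻¹-^ m gʲ≢0) ⟨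
        c ^ m * (gʲ ^ m) ⁻¹      ≡⟨ cong (λ t → c ^ m * t ⁻¹) (trans (^-comm g (toℕ j) m) (sym (proj₂ cᵐ-root))) ⟩
        c ^ m * (c ^ m) ⁻¹       ≡⟨ inverse (c ^ m) (x^n≢0 m c≢0) ⟩
        1#                       ∎
      root = kth-root k m km≡N c′≢0 c′ᵐ≡1
      s = proj₁ root
      sᵏ≡c′ : s ^ k ≡ c′
      sᵏ≡c′ = proj₂ root
      c≡sᵏgʲ : c ≡ s ^ k * gʲ
      c≡sᵏgʲ = trans (sym (*-⁻¹-cancelʳ c gʲ≢0)) (cong (_* gʲ) (sym sᵏ≡c′))

    separate : ∀ {i j : Fin k} {s t} → s ≢ 0# → t ≢ 0# → s ^ k * g ^ toℕ i ≡ t ^ k * g ^ toℕ j → i ≡ j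
    separate {i} {j} {s} {t} s≢0 t≢0 sᵏgⁱ≡tᵏgʲ = ^-injective prim i j (begin
      (g ^ m) ^ toℕ i          ≡⟨ ^-comm g m (toℕ i) ⟩
      (g ^ toℕ i) ^ m          ≡⟨ χ-kth-power (g ^ toℕ i) s≢0 ⟨
      (s ^ k * g ^ toℕ i) ^ m  ≡⟨ cong (_^ m) sᵏgⁱ≡tᵏgʲ ⟩
      (t ^ k * g ^ toℕ j) ^ m  ≡⟨ χ-kth-power (g ^ toℕ j) t≢0 ⟩
      (g ^ toℕ j) ^ m          ≡⟨ ^-comm g (toℕ j) m ⟩
      (g ^ m) ^ toℕ j          ∎)
      where open ≡-Reasoning

isCommutativeRing-from-laws :
  {A : Set} (_+_ _*_ : Op₂ A) (-_ : Op₁ A) (0# 1# : A) →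
  (∀ x y z → (x + y) + z ≡ x + (y + z)) → (∀ x y → x + y ≡ y + x) →
  (∀ x → 0# + x ≡ x) → (∀ x → (- x) + x ≡ 0#) →
  (∀ x y z → (x * y) * z ≡ x * (y * z)) → (∀ x y → x * y ≡ y * x) → (∀ x → 1# * x ≡ x) →
  (∀ x y z → (y + z) * x ≡ (y * x) + (z * x)) →
  IsCommutativeRing _≡_ _+_ _*_ -_ 0# 1#
isCommutativeRing-from-laws _+_ _*_ -_ 0# 1# +-assoc +-comm +-identityˡ -‿inverseˡ *-assoc *-comm *-identityˡ distribʳ = record
  { isRing = record
    { +-isAbelianGroup = record
      { isGroup = record
        { isMonoid = record
          { isSemigroup = record
            { isMagma = record { isEquivalence = isEquivalence ; ∙-cong = cong₂ _+_ }
            ; assoc   = +-assoc }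
          ; identity = +-identityˡ , λ x → trans (+-comm x 0#) (+-identityˡ x) }
        ; inverse = -‿inverseˡ , λ x → trans (+-comm x (- x)) (-‿inverseˡ x)
        ; ⁻¹-cong = cong -_ }
      ; comm = +-comm }
    ; *-cong     = cong₂ _*_
    ; *-assoc    = *-assoc
    ; *-identity = *-identityˡ , λ x → trans (*-comm x 1#) (*-identityˡ x)
    ; distrib    = (λ x y z → trans (*-comm x (y + z)) (trans (distribʳ x y z) (cong₂ _+_ (*-comm y x) (*-comm z x))))
                 , distribʳ }
  ; *-comm = *-comm }

-- F(√d) for a non-square d: pairs (a , b) stand for a + b √d.
module QuadraticExtension (F : Field) (_≟_ : DecidableEquality (Field.Carrier F))
                          (d : Field.Carrier F) (d-nonsquare : ∀ t → Field._^_ F t 2 ≢ d) where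

  open FieldProperties F
  open DecidableFieldProperties F _≟_

  Element : Set
  Element = Carrier × Carrier

  _⊕_ _⊗_ : Op₂ Element
  (a , b) ⊕ (a′ , b′) = (a + a′ , b + b′)
  (a , b) ⊗ (a′ , b′) = (a * a′ + d * (b * b′) , a * b′ + b * a′)

  ⊖_ : Op₁ Element
  ⊖ (a , b) = (- a , - b)

  𝟘 𝟙 : Element
  𝟘 = (0# , 0#)
  𝟙 = (1# , 0#)

  norm : Element → Carrier
  norm (a , b) = (a ^ 2) - (d * b ^ 2)

  norm-≢0 : ∀ x → x ≢ 𝟘 → norm x ≢ 0#
  norm-≢0 (a , b) x≢0 N≡0 with b ≟ 0#
  ... | yes refl = x≢0 (cong (_, 0#) (x^n≡0⇒x≡0 2
                     (trans (solve 2 (λ a d → a :^ 2 := a :^ 2 :- d :* # 0 :^ 2) refl a d) N≡0)))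
  ... | no  b≢0  = d-nonsquare (a * b ⁻¹) (^-ratio 2 b≢0 (x-y≡0⇒x≡y N≡0))

  _⁻¹′ : Op₁ Element
  (a , b) ⁻¹′ = (a * norm (a , b) ⁻¹ , - (b * norm (a , b) ⁻¹))

  ⊕-assoc : ∀ x y z → (x ⊕ y) ⊕ z ≡ x ⊕ (y ⊕ z)
  ⊕-assoc (a , b) (c , e) (f , g) = cong₂ _,_ (+-assoc a c f) (+-assoc b e g)

  ⊕-comm : ∀ x y → x ⊕ y ≡ y ⊕ x
  ⊕-comm (a , b) (c , e) = cong₂ _,_ (+-comm a c) (+-comm b e)

  ⊕-identityˡ : ∀ x → 𝟘 ⊕ x ≡ x
  ⊕-identityˡ (a , b) = cong₂ _,_ (+-identityˡ a) (+-identityˡ b)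

  ⊖-inverseˡ : ∀ x → (⊖ x) ⊕ x ≡ 𝟘
  ⊖-inverseˡ (a , b) = cong₂ _,_ (-‿inverseˡ a) (-‿inverseˡ b)

  ⊗-assoc : ∀ x y z → (x ⊗ y) ⊗ z ≡ x ⊗ (y ⊗ z)
  ⊗-assoc (a , b) (c , e) (f , g) = cong₂ _,_
    (solve 7 (λ d a b c e f g → (a :* c :+ d :* (b :* e)) :* f :+ d :* ((a :* e :+ b :* c) :* g)
                             := a :* (c :* f :+ d :* (e :* g)) :+ d :* (b :* (c :* g :+ e :* f))) refl d a b c e f g)
    (solve 7 (λ d a b c e f g → (a :* c :+ d :* (b :* e)) :* g :+ (a :* e :+ b :* c) :* f
                             := a :* (c :* g :+ e :* f) :+ b :* (c :* f :+ d :* (e :* g))) refl d a b c e f g)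

  ⊗-comm : ∀ x y → x ⊗ y ≡ y ⊗ x
  ⊗-comm (a , b) (c , e) = cong₂ _,_
    (solve 5 (λ d a b c e → a :* c :+ d :* (b :* e) := c :* a :+ d :* (e :* b)) refl d a b c e)
    (solve 5 (λ d a b c e → a :* e :+ b :* c := c :* b :+ e :* a) refl d a b c e)

  ⊗-identityˡ : ∀ x → 𝟙 ⊗ x ≡ x
  ⊗-identityˡ (a , b) = cong₂ _,_
    (solve 3 (λ d a b → # 1 :* a :+ d :* (# 0 :* b) := a) refl d a b)
    (solve 3 (λ d a b → # 1 :* b :+ # 0 :* a := b) refl d a b)

  ⊗-distribʳ : ∀ x y z → (y ⊕ z) ⊗ x ≡ (y ⊗ x) ⊕ (z ⊗ x)
  ⊗-distribʳ (a , b) (c , e) (f , g) = cong₂ _,_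
    (solve 7 (λ d a b c e f g → (c :+ f) :* a :+ d :* ((e :+ g) :* b)
                             := (c :* a :+ d :* (e :* b)) :+ (f :* a :+ d :* (g :* b))) refl d a b c e f g)
    (solve 7 (λ d a b c e f g → (c :+ f) :* b :+ (e :+ g) :* a
                             := (c :* b :+ e :* a) :+ (f :* b :+ g :* a)) refl d a b c e f g)

  ⊗-inverse : ∀ x → x ≢ 𝟘 → x ⊗ (x ⁻¹′) ≡ 𝟙
  ⊗-inverse (a , b) x≢0 = cong₂ _,_
    (trans (solve 4 (λ d a b i → a :* (a :* i) :+ d :* (b :* (:- (b :* i))) := (a :^ 2 :- d :* b :^ 2) :* i)
                    refl d a b (norm (a , b) ⁻¹))
           (inverse _ (norm-≢0 (a , b) x≢0)))
    (solve 4 (λ d a b i → a :* (:- (b :* i)) :+ b :* (a :* i) := # 0) refl d a b (norm (a , b) ⁻¹))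

  extension : Field
  extension = record
    { Carrier = Element ; _+_ = _⊕_ ; _*_ = _⊗_ ; -_ = ⊖_ ; 0# = 𝟘 ; 1# = 𝟙 ; _⁻¹ = _⁻¹′
    ; isCommutativeRing = isCommutativeRing-from-laws _⊕_ _⊗_ ⊖_ 𝟘 𝟙
        ⊕-assoc ⊕-comm ⊕-identityˡ ⊖-inverseˡ ⊗-assoc ⊗-comm ⊗-identityˡ ⊗-distribʳ
    ; 0≢1 = λ 𝟘≡𝟙 → 0≢1 (cong proj₁ 𝟘≡𝟙)
    ; inverse = ⊗-inverse
    }

  embedding : FieldHom F extension
  embedding = record
    { map   = _, 0#
    ; map-+ = λ x y → cong (x + y ,_) (sym (+-identityʳ 0#))
    ; map-* = λ x y → cong₂ _,_ (solve 3 (λ d x y → x :* y := x :* y :+ d :* (# 0 :* # 0)) refl d x y)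
                                (solve 2 (λ x y → # 0 := x :* # 0 :+ # 0 :* y) refl x y)
    ; map-1 = refl }

  √d : Element
  √d = (0# , 1#)

  √d^2≡d : Field._^_ extension √d 2 ≡ (d , 0#)
  √d^2≡d = cong₂ _,_
    (solve 1 (λ d → # 0 :* (# 0 :* # 1 :+ d :* (# 1 :* # 0)) :+ d :* (# 1 :* (# 0 :* # 0 :+ # 1 :* # 1)) := d) refl d)
    (solve 1 (λ d → # 0 :* (# 0 :* # 0 :+ # 1 :* # 1) :+ # 1 :* (# 0 :* # 1 :+ d :* (# 1 :* # 0)) := # 0) refl d)

  _≟′_ : DecidableEquality Element
  _≟′_ = Product.≡-dec _≟_ _≟_

-- F(∛c) for a non-cube c: triples (x , y , z) stand for x + y ∛c + z ∛c².
module CubicExtension (F : Field) (_≟_ : DecidableEquality (Field.Carrier F))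
                      (c : Field.Carrier F) (c-noncube : ∀ t → Field._^_ F t 3 ≢ c) where

  open FieldProperties F
  open DecidableFieldProperties F _≟_

  Element : Set
  Element = Carrier × Carrier × Carrier

  _⊕_ _⊗_ : Op₂ Element
  (x , y , z) ⊕ (x′ , y′ , z′) = (x + x′ , y + y′ , z + z′)
  (x , y , z) ⊗ (x′ , y′ , z′) =
    (x * x′ + c * (y * z′ + z * y′) , x * y′ + y * x′ + c * (z * z′) , x * z′ + y * y′ + z * x′)

  ⊖_ : Op₁ Element
  ⊖ (x , y , z) = (- x , - y , - z)

  𝟘 𝟙 : Element
  𝟘 = (0# , 0# , 0#)
  𝟙 = (1# , 0# , 0#)

  norm : Element → Carrier
  norm (x , y , z) = (x ^ 3 + c * y ^ 3 + c ^ 2 * z ^ 3) - (ι 3 * (c * (x * (y * z))))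

  -- With D = y² - xz and u = cz² - xy one has u³ - cD³ = (cz³ - y³) norm and
  -- y³ - cz³ = yD - zu; so a nonzero element of norm 0 would exhibit c as a cube.
  norm-≢0 : ∀ w → w ≢ 𝟘 → norm w ≢ 0#
  norm-≢0 (x , y , z) w≢0 N≡0 = cases (D ≟ 0#) (z ≟ 0#)
    where
    D = (y ^ 2) - (x * z)
    u = (c * z ^ 2) - (x * y)
    u³≡cD³ : u ^ 3 ≡ c * D ^ 3
    u³≡cD³ = x-y≡0⇒x≡y (begin
      (u ^ 3) - (c * D ^ 3)                          ≡⟨ solve 4 (λ x y z c →
          (c :* z :^ 2 :- x :* y) :^ 3 :- c :* (y :^ 2 :- x :* z) :^ 3
       := (c :* z :^ 3 :- y :^ 3) :* ((x :^ 3 :+ c :* y :^ 3 :+ c :^ 2 :* z :^ 3) :- # 3 :* (c :* (x :* (y :* z)))))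
          refl x y z c ⟩
      ((c * z ^ 3) - (y ^ 3)) * norm (x , y , z)     ≡⟨ cong (((c * z ^ 3) - (y ^ 3)) *_) N≡0 ⟩
      ((c * z ^ 3) - (y ^ 3)) * 0#                   ≡⟨ zeroʳ _ ⟩
      0#                                             ∎)
      where open ≡-Reasoning
    y³≡cz³ : D ≡ 0# → y ^ 3 ≡ c * z ^ 3
    y³≡cz³ D≡0 = x-y≡0⇒x≡y (begin
      (y ^ 3) - (c * z ^ 3)        ≡⟨ solve 4 (λ x y z c → y :^ 3 :- c :* z :^ 3
                                        := y :* (y :^ 2 :- x :* z) :- z :* (c :* z :^ 2 :- x :* y)) refl x y z c ⟩
      (y * D) - (z * u)            ≡⟨ cong₂ (λ D u → (y * D) - (z * u)) D≡0 u≡0 ⟩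
      (y * 0#) - (z * 0#)          ≡⟨ solve 2 (λ y z → y :* # 0 :- z :* # 0 := # 0) refl y z ⟩
      0#                           ∎)
      where
      open ≡-Reasoning
      u≡0 : u ≡ 0#
      u≡0 = x^n≡0⇒x≡0 3 (trans u³≡cD³ (trans (cong (λ D → c * D ^ 3) D≡0) (solve 1 (λ c → c :* # 0 :^ 3 := # 0) refl c)))
    cases : Dec (D ≡ 0#) → Dec (z ≡ 0#) → ⊥
    cases (no D≢0)  _         = c-noncube (u * D ⁻¹) (^-ratio 3 D≢0 u³≡cD³)
    cases (yes D≡0) (no z≢0)  = c-noncube (y * z ⁻¹) (^-ratio 3 z≢0 (y³≡cz³ D≡0))
    cases (yes D≡0) (yes z≡0) = w≢0 (cong₂ _,_ x≡0 (cong₂ _,_ y≡0 z≡0))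
      where
      y≡0 : y ≡ 0#
      y≡0 = x^n≡0⇒x≡0 2 (begin
        y ^ 2                   ≡⟨ solve 3 (λ x y z → y :^ 2 := (y :^ 2 :- x :* z) :+ x :* z) refl x y z ⟩
        D + x * z               ≡⟨ cong₂ (λ D z → D + x * z) D≡0 z≡0 ⟩
        0# + x * 0#             ≡⟨ solve 1 (λ x → # 0 :+ x :* # 0 := # 0) refl x ⟩
        0#                      ∎)
        where open ≡-Reasoning
      x≡0 : x ≡ 0#
      x≡0 = x^n≡0⇒x≡0 3 (begin
        x ^ 3                   ≡⟨ solve 2 (λ x c → x :^ 3
                                     := (x :^ 3 :+ c :* # 0 :^ 3 :+ c :^ 2 :* # 0 :^ 3) :- # 3 :* (c :* (x :* (# 0 :* # 0)))) refl x c ⟩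
        norm (x , 0# , 0#)      ≡⟨ cong₂ (λ y z → norm (x , y , z)) y≡0 z≡0 ⟨
        norm (x , y , z)        ≡⟨ N≡0 ⟩
        0#                      ∎)
        where open ≡-Reasoning

  adjugate : Element → Element
  adjugate (x , y , z) = ((x ^ 2) - (c * (y * z)) , (c * z ^ 2) - (x * y) , (y ^ 2) - (x * z))

  _⁻¹′ : Op₁ Element
  w ⁻¹′ = let (x , y , z) = adjugate w ; i = norm w ⁻¹ in (i * x , i * y , i * z)

  ⊗-inverse : ∀ w → w ≢ 𝟘 → w ⊗ (w ⁻¹′) ≡ 𝟙
  ⊗-inverse (x , y , z) w≢0 = cong₂ _,_ (trans e₁ (inverse _ (norm-≢0 (x , y , z) w≢0))) (cong₂ _,_ e₂ e₃)
    where
    i = norm (x , y , z) ⁻¹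
    e₁ : x * (i * ((x ^ 2) - (c * (y * z)))) + c * (y * (i * ((y ^ 2) - (x * z))) + z * (i * ((c * z ^ 2) - (x * y))))
       ≡ norm (x , y , z) * i
    e₁ = solve 5 (λ c x y z i →
           x :* (i :* (x :^ 2 :- c :* (y :* z))) :+ c :* (y :* (i :* (y :^ 2 :- x :* z)) :+ z :* (i :* (c :* z :^ 2 :- x :* y)))
        := ((x :^ 3 :+ c :* y :^ 3 :+ c :^ 2 :* z :^ 3) :- # 3 :* (c :* (x :* (y :* z)))) :* i) refl c x y z i
    e₂ : x * (i * ((c * z ^ 2) - (x * y))) + y * (i * ((x ^ 2) - (c * (y * z)))) + c * (z * (i * ((y ^ 2) - (x * z)))) ≡ 0#
    e₂ = solve 5 (λ c x y z i →
           x :* (i :* (c :* z :^ 2 :- x :* y)) :+ y :* (i :* (x :^ 2 :- c :* (y :* z))) :+ c :* (z :* (i :* (y :^ 2 :- x :* z)))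
        := # 0) refl c x y z i
    e₃ : x * (i * ((y ^ 2) - (x * z))) + y * (i * ((c * z ^ 2) - (x * y))) + z * (i * ((x ^ 2) - (c * (y * z)))) ≡ 0#
    e₃ = solve 5 (λ c x y z i →
           x :* (i :* (y :^ 2 :- x :* z)) :+ y :* (i :* (c :* z :^ 2 :- x :* y)) :+ z :* (i :* (x :^ 2 :- c :* (y :* z)))
        := # 0) refl c x y z i

  ⊕-assoc : ∀ w w′ w″ → (w ⊕ w′) ⊕ w″ ≡ w ⊕ (w′ ⊕ w″)
  ⊕-assoc (x , y , z) (x′ , y′ , z′) (x″ , y″ , z″) =
    cong₂ _,_ (+-assoc x x′ x″) (cong₂ _,_ (+-assoc y y′ y″) (+-assoc z z′ z″))

  ⊕-comm : ∀ w w′ → w ⊕ w′ ≡ w′ ⊕ w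
  ⊕-comm (x , y , z) (x′ , y′ , z′) = cong₂ _,_ (+-comm x x′) (cong₂ _,_ (+-comm y y′) (+-comm z z′))

  ⊕-identityˡ : ∀ w → 𝟘 ⊕ w ≡ w
  ⊕-identityˡ (x , y , z) = cong₂ _,_ (+-identityˡ x) (cong₂ _,_ (+-identityˡ y) (+-identityˡ z))

  ⊖-inverseˡ : ∀ w → (⊖ w) ⊕ w ≡ 𝟘
  ⊖-inverseˡ (x , y , z) = cong₂ _,_ (-‿inverseˡ x) (cong₂ _,_ (-‿inverseˡ y) (-‿inverseˡ z))

  ⊗-assoc : ∀ w w′ w″ → (w ⊗ w′) ⊗ w″ ≡ w ⊗ (w′ ⊗ w″)
  ⊗-assoc (x , y , z) (x′ , y′ , z′) (x″ , y″ , z″) = cong₂ _,_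
    (solve 10 (λ c x y z x′ y′ z′ x″ y″ z″ →
        (x :* x′ :+ c :* (y :* z′ :+ z :* y′)) :* x″ :+ c :* ((x :* y′ :+ y :* x′ :+ c :* (z :* z′)) :* z″ :+ (x :* z′ :+ y :* y′ :+ z :* x′) :* y″)
     := x :* (x′ :* x″ :+ c :* (y′ :* z″ :+ z′ :* y″)) :+ c :* (y :* (x′ :* z″ :+ y′ :* y″ :+ z′ :* x″) :+ z :* (x′ :* y″ :+ y′ :* x″ :+ c :* (z′ :* z″))))
       refl c x y z x′ y′ z′ x″ y″ z″)
    (cong₂ _,_
    (solve 10 (λ c x y z x′ y′ z′ x″ y″ z″ →
        (x :* x′ :+ c :* (y :* z′ :+ z :* y′)) :* y″ :+ (x :* y′ :+ y :* x′ :+ c :* (z :* z′)) :* x″ :+ c :* ((x :* z′ :+ y :* y′ :+ z :* x′) :* z″)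
     := x :* (x′ :* y″ :+ y′ :* x″ :+ c :* (z′ :* z″)) :+ y :* (x′ :* x″ :+ c :* (y′ :* z″ :+ z′ :* y″)) :+ c :* (z :* (x′ :* z″ :+ y′ :* y″ :+ z′ :* x″)))
       refl c x y z x′ y′ z′ x″ y″ z″)
    (solve 10 (λ c x y z x′ y′ z′ x″ y″ z″ →
        (x :* x′ :+ c :* (y :* z′ :+ z :* y′)) :* z″ :+ (x :* y′ :+ y :* x′ :+ c :* (z :* z′)) :* y″ :+ (x :* z′ :+ y :* y′ :+ z :* x′) :* x″
     := x :* (x′ :* z″ :+ y′ :* y″ :+ z′ :* x″) :+ y :* (x′ :* y″ :+ y′ :* x″ :+ c :* (z′ :* z″)) :+ z :* (x′ :* x″ :+ c :* (y′ :* z″ :+ z′ :* y″)))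
       refl c x y z x′ y′ z′ x″ y″ z″))

  ⊗-comm : ∀ w w′ → w ⊗ w′ ≡ w′ ⊗ w
  ⊗-comm (x , y , z) (x′ , y′ , z′) = cong₂ _,_
    (solve 7 (λ c x y z x′ y′ z′ → x :* x′ :+ c :* (y :* z′ :+ z :* y′) := x′ :* x :+ c :* (y′ :* z :+ z′ :* y)) refl c x y z x′ y′ z′)
    (cong₂ _,_
    (solve 7 (λ c x y z x′ y′ z′ → x :* y′ :+ y :* x′ :+ c :* (z :* z′) := x′ :* y :+ y′ :* x :+ c :* (z′ :* z)) refl c x y z x′ y′ z′)
    (solve 7 (λ c x y z x′ y′ z′ → x :* z′ :+ y :* y′ :+ z :* x′ := x′ :* z :+ y′ :* y :+ z′ :* x) refl c x y z x′ y′ z′))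

  ⊗-identityˡ : ∀ w → 𝟙 ⊗ w ≡ w
  ⊗-identityˡ (x , y , z) = cong₂ _,_
    (solve 4 (λ c x y z → # 1 :* x :+ c :* (# 0 :* z :+ # 0 :* y) := x) refl c x y z)
    (cong₂ _,_
    (solve 4 (λ c x y z → # 1 :* y :+ # 0 :* x :+ c :* (# 0 :* z) := y) refl c x y z)
    (solve 4 (λ c x y z → # 1 :* z :+ # 0 :* y :+ # 0 :* x := z) refl c x y z))

  ⊗-distribʳ : ∀ w w′ w″ → (w′ ⊕ w″) ⊗ w ≡ (w′ ⊗ w) ⊕ (w″ ⊗ w)
  ⊗-distribʳ (x , y , z) (x′ , y′ , z′) (x″ , y″ , z″) = cong₂ _,_
    (solve 10 (λ c x y z x′ y′ z′ x″ y″ z″ → (x′ :+ x″) :* x :+ c :* ((y′ :+ y″) :* z :+ (z′ :+ z″) :* y)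
        := (x′ :* x :+ c :* (y′ :* z :+ z′ :* y)) :+ (x″ :* x :+ c :* (y″ :* z :+ z″ :* y))) refl c x y z x′ y′ z′ x″ y″ z″)
    (cong₂ _,_
    (solve 10 (λ c x y z x′ y′ z′ x″ y″ z″ → (x′ :+ x″) :* y :+ (y′ :+ y″) :* x :+ c :* ((z′ :+ z″) :* z)
        := (x′ :* y :+ y′ :* x :+ c :* (z′ :* z)) :+ (x″ :* y :+ y″ :* x :+ c :* (z″ :* z))) refl c x y z x′ y′ z′ x″ y″ z″)
    (solve 10 (λ c x y z x′ y′ z′ x″ y″ z″ → (x′ :+ x″) :* z :+ (y′ :+ y″) :* y :+ (z′ :+ z″) :* x
        := (x′ :* z :+ y′ :* y :+ z′ :* x) :+ (x″ :* z :+ y″ :* y :+ z″ :* x)) refl c x y z x′ y′ z′ x″ y″ z″))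

  extension : Field
  extension = record
    { Carrier = Element ; _+_ = _⊕_ ; _*_ = _⊗_ ; -_ = ⊖_ ; 0# = 𝟘 ; 1# = 𝟙 ; _⁻¹ = _⁻¹′
    ; isCommutativeRing = isCommutativeRing-from-laws _⊕_ _⊗_ ⊖_ 𝟘 𝟙
        ⊕-assoc ⊕-comm ⊕-identityˡ ⊖-inverseˡ ⊗-assoc ⊗-comm ⊗-identityˡ ⊗-distribʳ
    ; 0≢1 = λ 𝟘≡𝟙 → 0≢1 (cong proj₁ 𝟘≡𝟙)
    ; inverse = ⊗-inverse
    }

  embedding : FieldHom F extension
  embedding = record
    { map   = λ x → (x , 0# , 0#)
    ; map-+ = λ x y → cong (x + y ,_) (cong₂ _,_ (sym (+-identityʳ 0#)) (sym (+-identityʳ 0#)))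
    ; map-* = λ x y → cong₂ _,_ (solve 3 (λ c x y → x :* y := x :* y :+ c :* (# 0 :* # 0 :+ # 0 :* # 0)) refl c x y)
                      (cong₂ _,_ (solve 3 (λ c x y → # 0 := x :* # 0 :+ # 0 :* y :+ c :* (# 0 :* # 0)) refl c x y)
                                 (solve 2 (λ x y → # 0 := x :* # 0 :+ # 0 :* # 0 :+ # 0 :* y) refl x y))
    ; map-1 = refl }

  ∛c : Element
  ∛c = (0# , 1# , 0#)

  ∛c⊗ : ∀ x y z → ∛c ⊗ (x , y , z) ≡ (c * z , x , y)
  ∛c⊗ x y z = cong₂ _,_
    (solve 4 (λ c x y z → # 0 :* x :+ c :* (# 1 :* z :+ # 0 :* y) := c :* z) refl c x y z)
    (cong₂ _,_ (solve 4 (λ c x y z → # 0 :* y :+ # 1 :* x :+ c :* (# 0 :* z) := x) refl c x y z)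
               (solve 3 (λ x y z → # 0 :* z :+ # 1 :* y :+ # 0 :* x := y) refl x y z))

  ∛c^3≡c : Field._^_ extension ∛c 3 ≡ (c , 0# , 0#)
  ∛c^3≡c = begin
    ∛c ⊗ (∛c ⊗ (∛c ⊗ (1# , 0# , 0#)))      ≡⟨ cong (λ t → ∛c ⊗ (∛c ⊗ t)) (∛c⊗ 1# 0# 0#) ⟩
    ∛c ⊗ (∛c ⊗ (c * 0# , 1# , 0#))         ≡⟨ cong (∛c ⊗_) (∛c⊗ _ 1# 0#) ⟩
    ∛c ⊗ (c * 0# , c * 0# , 1#)            ≡⟨ ∛c⊗ _ _ 1# ⟩
    (c * 1# , c * 0# , c * 0#)             ≡⟨ cong₂ _,_ (*-identityʳ c) (cong₂ _,_ (zeroʳ c) (zeroʳ c)) ⟩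
    (c , 0# , 0#)                          ∎
    where open ≡-Reasoning

  _≟′_ : DecidableEquality Element
  _≟′_ = Product.≡-dec _≟_ (Product.≡-dec _≟_ _≟_)

-- Decidable equality and a complete list of elements suffice to decide whether an element
-- has a square or a cube root, and both survive the adjunction of such a root.
record EnumeratedField : Set₁ where
  field
    base       : Field
    _≟_        : DecidableEquality (Field.Carrier base)
    elements   : List (Field.Carrier base)
    ∈-elements : ∀ x → x ∈ elements

  open Field base public

id-hom : (F : Field) → FieldHom F F
id-hom F = record { map = λ x → x ; map-+ = λ _ _ → refl ; map-* = λ _ _ → refl ; map-1 = refl }

∘-hom : {F K L : Field} → FieldHom K L → FieldHom F K → FieldHom F L
∘-hom g h = record
  { map   = λ x → G.map (H.map x)
  ; map-+ = λ x y → trans (cong G.map (H.map-+ x y)) (G.map-+ _ _)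
  ; map-* = λ x y → trans (cong G.map (H.map-* x y)) (G.map-* _ _)
  ; map-1 = trans (cong G.map H.map-1) G.map-1 }
  where
  module G = FieldHom g
  module H = FieldHom h

ExtensionRoot : ℕ → (E : EnumeratedField) → EnumeratedField.Carrier E → Set₁
ExtensionRoot n E c =
  Σ[ E′ ∈ EnumeratedField ] Σ[ h ∈ FieldHom (EnumeratedField.base E) (EnumeratedField.base E′) ]
  Σ[ r ∈ EnumeratedField.Carrier E′ ] EnumeratedField._^_ E′ r n ≡ FieldHom.map h c

module _ (E : EnumeratedField) where

  open EnumeratedField E

  square-root : ∀ c → ExtensionRoot 2 E c
  square-root c with any? (λ t → (t ^ 2) ≟ c) elements
  ... | yes found = E , id-hom base , satisfied found
  ... | no  none  = E′ , embedding , √d , √d^2≡d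
    where
    open QuadraticExtension base _≟_ c (λ t → All.lookup (All.¬Any⇒All¬ elements none) (∈-elements t))
    E′ : EnumeratedField
    E′ = record
      { base = extension ; _≟_ = _≟′_ ; elements = cartesianProduct elements elements
      ; ∈-elements = λ { (x , y) → ∈.∈-cartesianProduct⁺ (∈-elements x) (∈-elements y) } }

  cube-root : ∀ c → ExtensionRoot 3 E c
  cube-root c with any? (λ t → (t ^ 3) ≟ c) elements
  ... | yes found = E , id-hom base , satisfied found
  ... | no  none  = E′ , embedding , ∛c , ∛c^3≡c
    where
    open CubicExtension base _≟_ c (λ t → All.lookup (All.¬Any⇒All¬ elements none) (∈-elements t))
    E′ : EnumeratedField
    E′ = record
      { base = extension ; _≟_ = _≟′_ ; elements = cartesianProduct elements (cartesianProduct elements elements)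
      ; ∈-elements = λ { (x , y , z) → ∈.∈-cartesianProduct⁺ (∈-elements x) (∈.∈-cartesianProduct⁺ (∈-elements y) (∈-elements z)) } }

ExtensionRoot-∘ : ∀ m n E c → ExtensionRoot m E c → (∀ E′ x → ExtensionRoot n E′ x) → ExtensionRoot (n ℕ.* m) E c
ExtensionRoot-∘ m n E c (E′ , h , s , sᵐ≡c) root with root E′ s
... | E″ , h′ , t , tⁿ≡s = E″ , ∘-hom h′ h , t , (begin
  t ^ (n ℕ.* m)             ≡⟨ ^-*-assoc t n m ⟨
  (t ^ n) ^ m               ≡⟨ cong (_^ m) tⁿ≡s ⟩
  FieldHom.map h′ s ^ m     ≡⟨ map-^ s m ⟨
  FieldHom.map h′ (s ^′ m)  ≡⟨ cong (FieldHom.map h′) sᵐ≡c ⟩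
  FieldHom.map h′ (FieldHom.map h c) ∎)
  where
  open ≡-Reasoning
  open FieldProperties (EnumeratedField.base E″)
  open FieldHomProperties h′ using (map-^)
  _^′_ = EnumeratedField._^_ E′

fourth-root : ∀ E c → ExtensionRoot 4 E c
fourth-root E c = ExtensionRoot-∘ 2 2 E c (square-root E c) square-root

sixth-root : ∀ E c → ExtensionRoot 6 E c
sixth-root E c = ExtensionRoot-∘ 3 2 E c (cube-root E c) square-root

module WeierstrassProperties (F : Field) (_≟_ : DecidableEquality (Field.Carrier F))
                             (2≢0 : Field.ι F 2 ≢ Field.0# F) (3≢0 : Field.ι F 3 ≢ Field.0# F) where

  open FieldProperties F
  open DecidableFieldProperties F _≟_
  open EC F

  ι[2ᵐ3ⁿ]≢0 : ∀ m n → ι (2 ℕ.^ m ℕ.* 3 ℕ.^ n) ≢ 0#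
  ι[2ᵐ3ⁿ]≢0 m n ι≡0 = x*y≢0 (subst (_≢ 0#) (sym (ι-^ 2 m)) (x^n≢0 m 2≢0))
                            (subst (_≢ 0#) (sym (ι-^ 3 n)) (x^n≢0 n 3≢0))
                            (trans (sym (ι-* (2 ℕ.^ m) (3 ℕ.^ n))) ι≡0)

  ^2⇒NonSquare : ∀ {D} → (∀ x → x ^ 2 ≢ D) → NonSquare D
  ^2⇒NonSquare D-nonsquare (x , x*x≡D) = D-nonsquare x (trans (cong (x *_) (*-identityʳ x)) x*x≡D)

  δ-b≡0 : ∀ {E} → b E ≡ 0# → δ E ≡ ι 4 * a E ^ 3
  δ-b≡0 {E} b≡0 = trans (cong (λ t → ι 4 * a E ^ 3 + ι 27 * t ^ 2) b≡0)
    (solve 2 (λ X t → X :+ t :* # 0 :^ 2 := X) refl (ι 4 * a E ^ 3) (ι 27))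

  δ-a≡0 : ∀ {E} → a E ≡ 0# → δ E ≡ ι 27 * b E ^ 2
  δ-a≡0 {E} a≡0 = trans (cong (λ t → ι 4 * t ^ 3 + ι 27 * b E ^ 2) a≡0)
    (solve 2 (λ Y t → t :* # 0 :^ 3 :+ Y := Y) refl (ι 27 * b E ^ 2) (ι 4))

  isEC-b≡0 : ∀ {E} → b E ≡ 0# → a E ≢ 0# → IsEC E
  isEC-b≡0 b≡0 a≢0 = subst (_≢ 0#) (sym (δ-b≡0 b≡0)) (x*y≢0 (ι[2ᵐ3ⁿ]≢0 2 0) (x^n≢0 3 a≢0))

  isEC-a≡0 : ∀ {E} → a E ≡ 0# → b E ≢ 0# → IsEC E
  isEC-a≡0 a≡0 b≢0 = subst (_≢ 0#) (sym (δ-a≡0 a≡0)) (x*y≢0 (ι[2ᵐ3ⁿ]≢0 0 3) (x^n≢0 2 b≢0))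

  isEC∧b≡0⇒a≢0 : ∀ {E} → IsEC E → b E ≡ 0# → a E ≢ 0#
  isEC∧b≡0⇒a≢0 {E} δ≢0 b≡0 a≡0 = δ≢0 (begin
    δ E                 ≡⟨ δ-b≡0 b≡0 ⟩
    ι 4 * a E ^ 3       ≡⟨ cong (λ t → ι 4 * t ^ 3) a≡0 ⟩
    ι 4 * 0# ^ 3        ≡⟨ solve 1 (λ t → t :* # 0 :^ 3 := # 0) refl (ι 4) ⟩
    0#                  ∎)
    where open ≡-Reasoning

  isEC∧a≡0⇒b≢0 : ∀ {E} → IsEC E → a E ≡ 0# → b E ≢ 0#
  isEC∧a≡0⇒b≢0 {E} δ≢0 a≡0 b≡0 = δ≢0 (begin
    δ E                 ≡⟨ δ-a≡0 a≡0 ⟩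
    ι 27 * b E ^ 2      ≡⟨ cong (λ t → ι 27 * t ^ 2) b≡0 ⟩
    ι 27 * 0# ^ 2       ≡⟨ solve 1 (λ t → t :* # 0 :^ 2 := # 0) refl (ι 27) ⟩
    0#                  ∎)
    where open ≡-Reasoning

  j-intro : ∀ {E} k → IsEC E → ι 4 * a E ^ 3 ≡ k * δ E → j E ≡ ι 1728 * k
  j-intro k δ≢0 eq = cong (ι 1728 *_) (/-intro δ≢0 eq)

  j-b≡0 : ∀ {E} → b E ≡ 0# → a E ≢ 0# → j E ≡ ι 1728
  j-b≡0 b≡0 a≢0 = trans (j-intro 1# (isEC-b≡0 b≡0 a≢0) (trans (sym (*-identityˡ _)) (cong (1# *_) (sym (δ-b≡0 b≡0)))))
                        (*-identityʳ _)

  j≡1728⇒b≡0 : ∀ {E} → IsEC E → j E ≡ ι 1728 → b E ≡ 0#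
  j≡1728⇒b≡0 {E} δ≢0 j≡1728 = x^n≡0⇒x≡0 2 (x*y≡0⇒y≡0 (ι[2ᵐ3ⁿ]≢0 0 3) (begin
    ι 27 * b E ^ 2                     ≡⟨ solve 2 (λ X Y → Y := (X :+ Y) :- X) refl X (ι 27 * b E ^ 2) ⟩
    δ E - X                            ≡⟨ cong (_- X) X≡δ ⟨
    X - X                              ≡⟨ -‿inverseʳ X ⟩
    0#                                 ∎))
    where
    open ≡-Reasoning
    X = ι 4 * a E ^ 3
    X≡δ : X ≡ δ E
    X≡δ = begin
      X                    ≡⟨ *-⁻¹-cancelʳ X δ≢0 ⟨
      X / δ E * δ E        ≡⟨ cong (_* δ E) (*-cancelˡ (ι[2ᵐ3ⁿ]≢0 6 3) (trans j≡1728 (sym (*-identityʳ _)))) ⟩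
      1# * δ E             ≡⟨ *-identityˡ _ ⟩
      δ E                  ∎

  j≡0⇒a≡0 : ∀ {E} → IsEC E → j E ≡ 0# → a E ≡ 0#
  j≡0⇒a≡0 {E} δ≢0 j≡0 = x^n≡0⇒x≡0 3 (x*y≡0⇒y≡0 (ι[2ᵐ3ⁿ]≢0 2 0)
    (x*y≡0⇒y≡0 (x⁻¹≢0 δ≢0) (trans (*-comm _ _) (x*y≡0⇒y≡0 (ι[2ᵐ3ⁿ]≢0 6 3) j≡0))))

  ≡⇒Iso : ∀ {E T} → a T ≡ a E → b T ≡ b E → Iso E T
  ≡⇒Iso aT≡aE bT≡bE = 1# , 1≢0 , trans aT≡aE (sym (trans (cong (_* _) (^-zeroˡ 4)) (*-identityˡ _)))
                                , trans bT≡bE (sym (trans (cong (_* _) (^-zeroˡ 6)) (*-identityˡ _)))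

  Iso-sym : ∀ {E T} → Iso E T → Iso T E
  Iso-sym {E} {T} (u , u≢0 , aT≡ , bT≡) = u ⁻¹ , x⁻¹≢0 u≢0 ,
    sym (trans (cong ((u ⁻¹) ^ 4 *_) aT≡) (⁻¹^-cancelˡ 4 (a E) u≢0)) ,
    sym (trans (cong ((u ⁻¹) ^ 6 *_) bT≡) (⁻¹^-cancelˡ 6 (b E) u≢0))

  Iso-b≡0 : ∀ {E T u} → u ≢ 0# → b E ≡ 0# → b T ≡ 0# → a T ≡ u ^ 4 * a E → Iso E T
  Iso-b≡0 {E} {T} {u} u≢0 bE≡0 bT≡0 aT≡ = u , u≢0 , aT≡ , trans bT≡0 (sym (trans (cong (u ^ 6 *_) bE≡0) (zeroʳ _)))

  Iso-a≡0 : ∀ {E T u} → u ≢ 0# → a E ≡ 0# → a T ≡ 0# → b T ≡ u ^ 6 * b E → Iso E T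
  Iso-a≡0 {E} {T} {u} u≢0 aE≡0 aT≡0 bT≡ = u , u≢0 , trans aT≡0 (sym (trans (cong (u ^ 4 *_) aE≡0) (zeroʳ _))) , bT≡

  a-Hess-b≡0 : ∀ {E} → b E ≡ 0# → a E ≢ 0# → a (Hess E) * (ι 3 * a E) ≡ - 1#
  a-Hess-b≡0 {E} b≡0 a≢0 = begin
    (- (((A ^ 3) / ι 3 + ι 3 * b E ^ 2) / (A ^ 4))) * (ι 3 * A)
      ≡⟨ cong (λ t → (- (((A ^ 3) / ι 3 + ι 3 * t ^ 2) / (A ^ 4))) * (ι 3 * A)) b≡0 ⟩
    (- ((A ^ 3 * i₃ + ι 3 * 0# ^ 2) * j₄)) * (ι 3 * A)
      ≡⟨ solve 4 (λ A i₃ j₄ t → (:- ((A :^ 3 :* i₃ :+ t :* # 0 :^ 2) :* j₄)) :* (t :* A)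
                            := :- ((A :^ 4 :* j₄) :* (t :* i₃))) refl A i₃ j₄ (ι 3) ⟩
    - ((A ^ 4 * j₄) * (ι 3 * i₃))
      ≡⟨ cong₂ (λ x y → - (x * y)) (inverse (A ^ 4) (x^n≢0 4 a≢0)) (inverse (ι 3) 3≢0) ⟩
    - (1# * 1#)
      ≡⟨ cong -_ (*-identityʳ 1#) ⟩
    - 1#
      ∎
    where
    open ≡-Reasoning
    A = a E
    i₃ = ι 3 ⁻¹
    j₄ = (A ^ 4) ⁻¹

  b-Hess-b≡0 : ∀ {E} → b E ≡ 0# → b (Hess E) ≡ 0#
  b-Hess-b≡0 {E} b≡0 = begin
    - ((A ^ 3 * (b E / ι 3) + ι 2 * b E ^ 3) / (A ^ 6))
      ≡⟨ cong (λ t → - ((A ^ 3 * (t / ι 3) + ι 2 * t ^ 3) / (A ^ 6))) b≡0 ⟩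
    - ((A ^ 3 * (0# * ι 3 ⁻¹) + ι 2 * 0# ^ 3) * (A ^ 6) ⁻¹)
      ≡⟨ solve 4 (λ A i j t → :- ((A :^ 3 :* (# 0 :* i) :+ t :* # 0 :^ 3) :* j) := # 0) refl A (ι 3 ⁻¹) ((A ^ 6) ⁻¹) (ι 2) ⟩
    0#
      ∎
    where
    open ≡-Reasoning
    A = a E

  Iso-Hess-b≡0 : ∀ {E} → b E ≡ 0# → a E ≢ 0# →
                 Iso E (Hess E) ⇔ (Σ[ t ∈ Carrier ] (t ≢ 0#) × (t ^ 4 ≡ - (ι 3 * a E ^ 2)))
  Iso-Hess-b≡0 {E} b≡0 a≢0 = mk⇔ to from
    where
    A = a E
    aH[3A]≡-1 : a (Hess E) * (ι 3 * A) ≡ - 1#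
    aH[3A]≡-1 = a-Hess-b≡0 b≡0 a≢0
    to : Iso E (Hess E) → Σ[ t ∈ Carrier ] (t ≢ 0#) × (t ^ 4 ≡ - (ι 3 * A ^ 2))
    to (u , u≢0 , aH≡u⁴A , _) = u ⁻¹ , x⁻¹≢0 u≢0 , *-cancelˡ (x^n≢0 4 u≢0) (begin
      u ^ 4 * (u ⁻¹) ^ 4              ≡⟨ ^-distribʳ-* u (u ⁻¹) 4 ⟨
      (u * u ⁻¹) ^ 4                  ≡⟨ cong (_^ 4) (inverse u u≢0) ⟩
      1# ^ 4                          ≡⟨ ^-zeroˡ 4 ⟩
      1#                              ≡⟨ -‿involutive 1# ⟨
      - (- 1#)                        ≡⟨ cong -_ aH[3A]≡-1 ⟨
      - (a (Hess E) * (ι 3 * A))      ≡⟨ cong (λ t → - (t * (ι 3 * A))) aH≡u⁴A ⟩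
      - ((u ^ 4 * A) * (ι 3 * A))     ≡⟨ solve 3 (λ U t A → :- ((U :* A) :* (t :* A)) := U :* (:- (t :* A :^ 2))) refl (u ^ 4) (ι 3) A ⟩
      u ^ 4 * (- (ι 3 * A ^ 2))       ∎)
      where open ≡-Reasoning
    from : Σ[ t ∈ Carrier ] (t ≢ 0#) × (t ^ 4 ≡ - (ι 3 * A ^ 2)) → Iso E (Hess E)
    from (t , t≢0 , t⁴≡-3A²) = Iso-b≡0 (x⁻¹≢0 t≢0) b≡0 (b-Hess-b≡0 b≡0) (*-cancelˡ 3A≢0 (begin
      ι 3 * A * a (Hess E)                 ≡⟨ trans (*-comm _ _) aH[3A]≡-1 ⟩
      - 1#                                 ≡⟨ cong -_ (⁻¹^-cancelˡ 4 1# t≢0) ⟨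
      - ((t ⁻¹) ^ 4 * (t ^ 4 * 1#))        ≡⟨ cong (λ s → - ((t ⁻¹) ^ 4 * (s * 1#))) t⁴≡-3A² ⟩
      - ((t ⁻¹) ^ 4 * (- (ι 3 * A ^ 2) * 1#))
                                           ≡⟨ solve 3 (λ T k A → :- (T :* (:- (k :* A :^ 2) :* # 1)) := (k :* A) :* (T :* A)) refl ((t ⁻¹) ^ 4) (ι 3) A ⟩
      ι 3 * A * ((t ⁻¹) ^ 4 * A)           ∎))
      where
      open ≡-Reasoning
      3A≢0 : ι 3 * A ≢ 0#
      3A≢0 = x*y≢0 3≢0 a≢0

  -- Named after their j-invariants -8·1728 and 4·1728.
  W₋₈ : Carrier → W
  W₋₈ s = mkW ((- ι 6) * s ^ 2) (ι 6 * s ^ 3)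

  W₄ : Carrier → W
  W₄ s = mkW ((- ι 9) * s ^ 2) (ι 9 * s ^ 3)

  private
    *[B/3] : ∀ A B → A ^ 3 * (B / ι 3) ≡ ((A ^ 3) / ι 3) * B
    *[B/3] A B = solve 3 (λ A B i → A :^ 3 :* (B :* i) := (A :^ 3 :* i) :* B) refl A B (ι 3 ⁻¹)

  W₋₈-isEC : ∀ {s} → s ≢ 0# → IsEC (W₋₈ s)
  W₋₈-isEC {s} s≢0 = subst (_≢ 0#) (sym δ≡) (x*y≢0 (ι[2ᵐ3ⁿ]≢0 2 3) (x^n≢0 6 s≢0))
    where
    δ≡ : δ (W₋₈ s) ≡ ι 108 * s ^ 6
    δ≡ = solve 1 (λ s → # 4 :* ((:- # 6) :* s :^ 2) :^ 3 :+ # 27 :* (# 6 :* s :^ 3) :^ 2 := # 108 :* s :^ 6) refl s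

  j-W₋₈ : ∀ {s} → s ≢ 0# → j (W₋₈ s) ≡ - (ι 8 * ι 1728)
  j-W₋₈ {s} s≢0 = trans (j-intro (- ι 8) (W₋₈-isEC s≢0)
      (solve 1 (λ s → # 4 :* ((:- # 6) :* s :^ 2) :^ 3
                   := (:- # 8) :* (# 4 :* ((:- # 6) :* s :^ 2) :^ 3 :+ # 27 :* (# 6 :* s :^ 3) :^ 2)) refl s))
    (solve 0 (# 1728 :* (:- # 8) := :- (# 8 :* # 1728)) refl)

  Hess-W₋₈ : ∀ {s} → s ≢ 0# → Hess (W₋₈ s) ≡ mkW (- ((ι 36 * s ^ 2) ⁻¹)) 0#
  Hess-W₋₈ {s} s≢0 = cong₂ mkW (cong -_ a≡) (trans (cong (λ t → - ((t + ι 2 * B ^ 3) / (A ^ 6))) (*[B/3] A B)) b≡)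
    where
    open ≡-Reasoning
    A = (- ι 6) * s ^ 2
    B = ι 6 * s ^ 3
    A³/3 : (A ^ 3) / ι 3 ≡ (- ι 72) * s ^ 6
    A³/3 = /-intro 3≢0 (solve 1 (λ s → ((:- # 6) :* s :^ 2) :^ 3 := ((:- # 72) :* s :^ 6) :* # 3) refl s)
    a≡ : ((A ^ 3) / ι 3 + ι 3 * B ^ 2) / (A ^ 4) ≡ (ι 36 * s ^ 2) ⁻¹
    a≡ = begin
      ((A ^ 3) / ι 3 + ι 3 * B ^ 2) / (A ^ 4)   ≡⟨ cong (λ t → (t + ι 3 * B ^ 2) / (A ^ 4)) A³/3 ⟩
      ((- ι 72) * s ^ 6 + ι 3 * B ^ 2) / (A ^ 4) ≡⟨ cong (_/ (A ^ 4)) (solve 1 (λ s →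
                                                     (:- # 72) :* s :^ 6 :+ # 3 :* (# 6 :* s :^ 3) :^ 2 := # 36 :* s :^ 6) refl s) ⟩
      (ι 36 * s ^ 6) / (A ^ 4)                   ≡⟨ ⁻¹≡/ (x^n≢0 4 (x*y≢0 (-x≢0 (ι[2ᵐ3ⁿ]≢0 1 1)) (x^n≢0 2 s≢0)))
                                                     (solve 1 (λ s → (# 36 :* s :^ 2) :* (# 36 :* s :^ 6) := ((:- # 6) :* s :^ 2) :^ 4) refl s) ⟨
      (ι 36 * s ^ 2) ⁻¹                          ∎
    b≡ : - ((((A ^ 3) / ι 3) * B + ι 2 * B ^ 3) / (A ^ 6)) ≡ 0#
    b≡ = begin
      - ((((A ^ 3) / ι 3) * B + ι 2 * B ^ 3) / (A ^ 6))   ≡⟨ cong (λ t → - ((t * B + ι 2 * B ^ 3) / (A ^ 6))) A³/3 ⟩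
      - ((((- ι 72) * s ^ 6) * B + ι 2 * B ^ 3) / (A ^ 6)) ≡⟨ solve 2 (λ s i → :- ((((:- # 72) :* s :^ 6) :* (# 6 :* s :^ 3)
                                                            :+ # 2 :* (# 6 :* s :^ 3) :^ 3) :* i) := # 0) refl s ((A ^ 6) ⁻¹) ⟩
      0#                                                   ∎

  W₄-isEC : ∀ {s} → s ≢ 0# → IsEC (W₄ s)
  W₄-isEC {s} s≢0 = subst (_≢ 0#) (sym δ≡) (x*y≢0 (-x≢0 (ι[2ᵐ3ⁿ]≢0 0 6)) (x^n≢0 6 s≢0))
    where
    δ≡ : δ (W₄ s) ≡ (- ι 729) * s ^ 6
    δ≡ = solve 1 (λ s → # 4 :* ((:- # 9) :* s :^ 2) :^ 3 :+ # 27 :* (# 9 :* s :^ 3) :^ 2 := (:- # 729) :* s :^ 6) refl s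

  j-W₄ : ∀ {s} → s ≢ 0# → j (W₄ s) ≡ ι 4 * ι 1728
  j-W₄ {s} s≢0 = trans (j-intro (ι 4) (W₄-isEC s≢0)
      (solve 1 (λ s → # 4 :* ((:- # 9) :* s :^ 2) :^ 3
                   := # 4 :* (# 4 :* ((:- # 9) :* s :^ 2) :^ 3 :+ # 27 :* (# 9 :* s :^ 3) :^ 2)) refl s))
    (*-comm _ _)

  Hess-W₄ : ∀ {s} → s ≢ 0# → Hess (W₄ s) ≡ mkW 0# ((ι 729 * s ^ 3) ⁻¹)
  Hess-W₄ {s} s≢0 = cong₂ mkW a≡ (trans (cong (λ t → - ((t + ι 2 * B ^ 3) / (A ^ 6))) (*[B/3] A B)) b≡)
    where
    open ≡-Reasoning
    A = (- ι 9) * s ^ 2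
    B = ι 9 * s ^ 3
    A³/3 : (A ^ 3) / ι 3 ≡ (- ι 243) * s ^ 6
    A³/3 = /-intro 3≢0 (solve 1 (λ s → ((:- # 9) :* s :^ 2) :^ 3 := ((:- # 243) :* s :^ 6) :* # 3) refl s)
    a≡ : - (((A ^ 3) / ι 3 + ι 3 * B ^ 2) / (A ^ 4)) ≡ 0#
    a≡ = begin
      - (((A ^ 3) / ι 3 + ι 3 * B ^ 2) / (A ^ 4))    ≡⟨ cong (λ t → - ((t + ι 3 * B ^ 2) / (A ^ 4))) A³/3 ⟩
      - (((- ι 243) * s ^ 6 + ι 3 * B ^ 2) / (A ^ 4)) ≡⟨ solve 2 (λ s i → :- (((:- # 243) :* s :^ 6
                                                           :+ # 3 :* (# 9 :* s :^ 3) :^ 2) :* i) := # 0) refl s ((A ^ 4) ⁻¹) ⟩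
      0#                                              ∎
    b≡ : - ((((A ^ 3) / ι 3) * B + ι 2 * B ^ 3) / (A ^ 6)) ≡ (ι 729 * s ^ 3) ⁻¹
    b≡ = begin
      - ((((A ^ 3) / ι 3) * B + ι 2 * B ^ 3) / (A ^ 6))    ≡⟨ cong (λ t → - ((t * B + ι 2 * B ^ 3) / (A ^ 6))) A³/3 ⟩
      - ((((- ι 243) * s ^ 6) * B + ι 2 * B ^ 3) / (A ^ 6)) ≡⟨ solve 2 (λ s i → :- ((((:- # 243) :* s :^ 6) :* (# 9 :* s :^ 3)
                                                                :+ # 2 :* (# 9 :* s :^ 3) :^ 3) :* i) := (# 729 :* s :^ 9) :* i) refl s ((A ^ 6) ⁻¹) ⟩
      (ι 729 * s ^ 9) / (A ^ 6)                             ≡⟨ ⁻¹≡/ (x^n≢0 6 (x*y≢0 (-x≢0 (ι[2ᵐ3ⁿ]≢0 0 2)) (x^n≢0 2 s≢0)))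
                                                                (solve 1 (λ s → (# 729 :* s :^ 3) :* (# 729 :* s :^ 9) := ((:- # 9) :* s :^ 2) :^ 6) refl s) ⟨
      (ι 729 * s ^ 3) ⁻¹                                    ∎

  a-Hess-W₋₈≢0 : ∀ {s} → s ≢ 0# → a (Hess (W₋₈ s)) ≢ 0#
  a-Hess-W₋₈≢0 {s} s≢0 = subst (λ H → a H ≢ 0#) (sym (Hess-W₋₈ s≢0))
    (-x≢0 (x⁻¹≢0 (x*y≢0 (ι[2ᵐ3ⁿ]≢0 2 2) (x^n≢0 2 s≢0))))

  b-Hess-W₋₈ : ∀ {s} → s ≢ 0# → b (Hess (W₋₈ s)) ≡ 0#
  b-Hess-W₋₈ s≢0 = cong b (Hess-W₋₈ s≢0)

  -- From 36 s² = u⁴ · 36 t², read off from the a-coefficients -1/(36 s²), -1/(36 t²).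
  Iso-Hess-W₋₈ : ∀ {s t} → s ≢ 0# → t ≢ 0# → Iso (Hess (W₋₈ s)) (Hess (W₋₈ t)) →
                 Σ[ u ∈ Carrier ] u ≢ 0# × s ^ 2 ≡ u ^ 4 * t ^ 2
  Iso-Hess-W₋₈ {s} {t} s≢0 t≢0 (u , u≢0 , aT≡ , _) = u , u≢0 , *-cancelˡ (ι[2ᵐ3ⁿ]≢0 2 2) (begin
    X                        ≡⟨ *-identityʳ X ⟨
    X * 1#                   ≡⟨ cong (X *_) (inverse Y Y≢0) ⟨
    X * (Y * Y ⁻¹)           ≡⟨ cong (λ z → X * (Y * z)) Y⁻¹≡u⁴X⁻¹ ⟩
    X * (Y * (U * X ⁻¹))     ≡⟨ solve 4 (λ X Y U Xi → X :* (Y :* (U :* Xi)) := (U :* Y) :* (X :* Xi)) refl X Y U (X ⁻¹) ⟩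
    (U * Y) * (X * X ⁻¹)     ≡⟨ cong ((U * Y) *_) (inverse X X≢0) ⟩
    (U * Y) * 1#             ≡⟨ solve 4 (λ U c t k → (U :* (c :* t)) :* # 1 := c :* (U :* t)) refl U (ι 36) (t ^ 2) 1# ⟩
    ι 36 * (U * t ^ 2)       ∎)
    where
    open ≡-Reasoning
    U = u ^ 4
    X = ι 36 * s ^ 2
    Y = ι 36 * t ^ 2
    X≢0 : X ≢ 0#
    X≢0 = x*y≢0 (ι[2ᵐ3ⁿ]≢0 2 2) (x^n≢0 2 s≢0)
    Y≢0 : Y ≢ 0#
    Y≢0 = x*y≢0 (ι[2ᵐ3ⁿ]≢0 2 2) (x^n≢0 2 t≢0)
    Y⁻¹≡u⁴X⁻¹ : Y ⁻¹ ≡ U * X ⁻¹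
    Y⁻¹≡u⁴X⁻¹ = begin
      Y ⁻¹                    ≡⟨ -‿involutive _ ⟨
      - (- (Y ⁻¹))            ≡⟨ cong (λ H → - a H) (Hess-W₋₈ t≢0) ⟨
      - a (Hess (W₋₈ t))      ≡⟨ cong -_ aT≡ ⟩
      - (U * a (Hess (W₋₈ s))) ≡⟨ cong (λ H → - (U * a H)) (Hess-W₋₈ s≢0) ⟩
      - (U * - (X ⁻¹))        ≡⟨ solve 2 (λ U x → :- (U :* (:- x)) := U :* x) refl U (X ⁻¹) ⟩
      U * X ⁻¹                ∎

  -- An isomorphism would give 6 D³ = u⁶ · 6, i.e. D = (u³/D)².
  ¬Iso-W₋₈ : ∀ {D} → D ≢ 0# → (∀ x → x ^ 2 ≢ D) → ¬ Iso (W₋₈ 1#) (W₋₈ D)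
  ¬Iso-W₋₈ {D} D≢0 D-nonsquare (u , u≢0 , _ , bD≡) = D-nonsquare (u ^ 3 * D ⁻¹) (^-ratio 2 D≢0 (begin
    (u ^ 3) ^ 2          ≡⟨ ^-*-assoc u 3 2 ⟩
    u ^ 6                ≡⟨ *-cancelˡ (ι[2ᵐ3ⁿ]≢0 1 1) (trans bD≡ (solve 2 (λ U c → U :* (c :* # 1 :^ 3) := c :* U) refl (u ^ 6) (ι 6))) ⟨
    D ^ 3                ≡⟨ solve 1 (λ D → D :^ 3 := D :* D :^ 2) refl D ⟩
    D * D ^ 2            ∎))
    where open ≡-Reasoning

  -- u = ζ² works because ζ⁸ = ζ² and ζ¹² = 1.
  Iso-W₄-rotate : ∀ {s t ζ} → ζ ^ 3 ≡ 1# → t ≡ ζ * s → Iso (W₄ s) (W₄ t)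
  Iso-W₄-rotate {s} {t} {ζ} ζ³≡1 t≡ζs = ζ ^ 2 , x^n≢0 2 (xⁿ≡1⇒x≢0 3 (s≤s z≤n) ζ³≡1) , a≡ , b≡
    where
    open ≡-Reasoning
    a≡ : (- ι 9) * t ^ 2 ≡ (ζ ^ 2) ^ 4 * ((- ι 9) * s ^ 2)
    a≡ = sym (begin
      (ζ ^ 2) ^ 4 * ((- ι 9) * s ^ 2)             ≡⟨ solve 2 (λ ζ s → (ζ :^ 2) :^ 4 :* ((:- # 9) :* s :^ 2)
                                                       := (ζ :^ 3 :* ζ :^ 3) :* ((:- # 9) :* (ζ :* s) :^ 2)) refl ζ s ⟩
      (ζ ^ 3 * ζ ^ 3) * ((- ι 9) * (ζ * s) ^ 2)   ≡⟨ cong (λ x → (x * x) * ((- ι 9) * (ζ * s) ^ 2)) ζ³≡1 ⟩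
      (1# * 1#) * ((- ι 9) * (ζ * s) ^ 2)         ≡⟨ solve 1 (λ x → (# 1 :* # 1) :* x := x) refl _ ⟩
      (- ι 9) * (ζ * s) ^ 2                       ≡⟨ cong (λ t → (- ι 9) * t ^ 2) t≡ζs ⟨
      (- ι 9) * t ^ 2                             ∎)
    b≡ : ι 9 * t ^ 3 ≡ (ζ ^ 2) ^ 6 * (ι 9 * s ^ 3)
    b≡ = sym (begin
      (ζ ^ 2) ^ 6 * (ι 9 * s ^ 3)                 ≡⟨ solve 2 (λ ζ s → (ζ :^ 2) :^ 6 :* (# 9 :* s :^ 3)
                                                       := (ζ :^ 3) :^ 3 :* (# 9 :* (ζ :* s) :^ 3)) refl ζ s ⟩
      (ζ ^ 3) ^ 3 * (ι 9 * (ζ * s) ^ 3)           ≡⟨ cong (λ x → x ^ 3 * (ι 9 * (ζ * s) ^ 3)) ζ³≡1 ⟩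
      1# ^ 3 * (ι 9 * (ζ * s) ^ 3)                ≡⟨ solve 1 (λ x → # 1 :^ 3 :* x := x) refl _ ⟩
      ι 9 * (ζ * s) ^ 3                           ≡⟨ cong (λ t → ι 9 * t ^ 3) t≡ζs ⟨
      ι 9 * t ^ 3                                 ∎)

  W₄-rotate-≢ : ∀ {s t ζ} → s ≢ 0# → ζ ^ 2 ≢ 1# → t ≡ ζ * s → W₄ s ≢ W₄ t
  W₄-rotate-≢ {s} {t} {ζ} s≢0 ζ²≢1 t≡ζs W₄s≡W₄t = ζ²≢1 (*-cancelˡ k≢0 (begin
    k * ζ ^ 2                ≡⟨ solve 2 (λ s ζ → ((:- # 9) :* s :^ 2) :* ζ :^ 2 := (:- # 9) :* (ζ :* s) :^ 2) refl s ζ ⟩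
    (- ι 9) * (ζ * s) ^ 2    ≡⟨ cong (λ t → (- ι 9) * t ^ 2) t≡ζs ⟨
    a (W₄ t)                 ≡⟨ cong a W₄s≡W₄t ⟨
    k                        ≡⟨ *-identityʳ k ⟨
    k * 1#                   ∎))
    where
    open ≡-Reasoning
    k = (- ι 9) * s ^ 2
    k≢0 : k ≢ 0#
    k≢0 = x*y≢0 (-x≢0 (ι[2ᵐ3ⁿ]≢0 0 2)) (x^n≢0 2 s≢0)

  Hess-W₄-rotate : ∀ {s t ζ} → s ≢ 0# → ζ ^ 3 ≡ 1# → t ≡ ζ * s → Hess (W₄ s) ≡ Hess (W₄ t)
  Hess-W₄-rotate {s} {t} {ζ} s≢0 ζ³≡1 t≡ζs = begin
    Hess (W₄ s)                       ≡⟨ Hess-W₄ s≢0 ⟩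
    mkW 0# ((ι 729 * s ^ 3) ⁻¹)       ≡⟨ cong (λ x → mkW 0# ((ι 729 * x) ⁻¹)) s³≡t³ ⟩
    mkW 0# ((ι 729 * t ^ 3) ⁻¹)       ≡⟨ Hess-W₄ t≢0 ⟨
    Hess (W₄ t)                       ∎
    where
    open ≡-Reasoning
    t≢0 : t ≢ 0#
    t≢0 = subst (_≢ 0#) (sym t≡ζs) (x*y≢0 (xⁿ≡1⇒x≢0 3 (s≤s z≤n) ζ³≡1) s≢0)
    s³≡t³ : s ^ 3 ≡ t ^ 3
    s³≡t³ = begin
      s ^ 3                 ≡⟨ *-identityˡ _ ⟨
      1# * s ^ 3            ≡⟨ cong (_* s ^ 3) ζ³≡1 ⟨
      ζ ^ 3 * s ^ 3         ≡⟨ ^-distribʳ-* ζ s 3 ⟨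
      (ζ * s) ^ 3           ≡⟨ cong (_^ 3) t≡ζs ⟨
      t ^ 3                 ∎

  Iso-Hess-W₄ : ∀ {s T} → s ≢ 0# → a T ≡ 0# → b T ≡ s ^ 3 → Iso (Hess (W₄ s)) T
  Iso-Hess-W₄ {s} {T} s≢0 aT≡0 bT≡s³ =
    Iso-a≡0 (x*y≢0 3≢0 s≢0) (cong a (Hess-W₄ s≢0)) aT≡0 (begin
      b T                                          ≡⟨ bT≡s³ ⟩
      s ^ 3                                        ≡⟨ *-identityʳ _ ⟨
      s ^ 3 * 1#                                   ≡⟨ cong (s ^ 3 *_) (inverse k k≢0) ⟨
      s ^ 3 * (k * k ⁻¹)                           ≡⟨ solve 2 (λ s i → s :^ 3 :* ((# 729 :* s :^ 3) :* i)
                                                        := (# 3 :* s) :^ 6 :* i) refl s (k ⁻¹) ⟩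
      (ι 3 * s) ^ 6 * k ⁻¹                         ≡⟨ cong (λ H → (ι 3 * s) ^ 6 * b H) (Hess-W₄ s≢0) ⟨
      (ι 3 * s) ^ 6 * b (Hess (W₄ s))              ∎)
    where
    open ≡-Reasoning
    k = ι 729 * s ^ 3
    k≢0 : k ≢ 0#
    k≢0 = x*y≢0 (ι[2ᵐ3ⁿ]≢0 0 6) (x^n≢0 3 s≢0)

  HessOfThree-W₄ : ∀ {ω s T} → IsPrimitiveRoot 3 ω → s ≢ 0# → a T ≡ 0# → b T ≡ s ^ 3 → HessOfThree T
  HessOfThree-W₄ {ω} {s} {T} (ω³≡1 , minimal) s≢0 aT≡0 bT≡s³ =
    W₄ s , W₄ (ω * s) , W₄ (ω * (ω * s)) ,
    (W₄-isEC s≢0 , W₄-isEC ωs≢0 , W₄-isEC ω²s≢0) , j-W₄ s≢0 , j-W₄ ωs≢0 , j-W₄ ω²s≢0 ,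
    W₄-rotate-≢ s≢0 ω²≢1 refl , W₄-rotate-≢ s≢0 ω⁴≢1 ω[ωs]≡ω²s , W₄-rotate-≢ ωs≢0 ω²≢1 refl ,
    Iso-W₄-rotate ω³≡1 refl , Iso-W₄-rotate ω²³≡1 ω[ωs]≡ω²s , Iso-W₄-rotate ω³≡1 refl ,
    Hess-W₄-rotate s≢0 ω³≡1 refl , Hess-W₄-rotate s≢0 ω²³≡1 ω[ωs]≡ω²s ,
    Iso-Hess-W₄ s≢0 aT≡0 bT≡s³
    where
    ω≢0 : ω ≢ 0#
    ω≢0 = xⁿ≡1⇒x≢0 3 (s≤s z≤n) ω³≡1
    ωs≢0 : ω * s ≢ 0#
    ωs≢0 = x*y≢0 ω≢0 s≢0
    ω²s≢0 : ω * (ω * s) ≢ 0#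
    ω²s≢0 = x*y≢0 ω≢0 ωs≢0
    ω²≢1 : ω ^ 2 ≢ 1#
    ω²≢1 = minimal 2 (s≤s z≤n) (s≤s (s≤s (s≤s z≤n)))
    ω⁴≢1 : (ω ^ 2) ^ 2 ≢ 1#
    ω⁴≢1 ω⁴≡1 = minimal 1 (s≤s z≤n) (s≤s (s≤s z≤n)) (begin
      ω ^ 1                  ≡⟨ *-identityˡ _ ⟨
      1# * ω ^ 1             ≡⟨ cong (_* ω ^ 1) ω³≡1 ⟨
      ω ^ 3 * ω ^ 1          ≡⟨ solve 1 (λ ω → ω :^ 3 :* ω :^ 1 := (ω :^ 2) :^ 2) refl ω ⟩
      (ω ^ 2) ^ 2            ≡⟨ ω⁴≡1 ⟩
      1#                     ∎)
      where open ≡-Reasoning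
    ω²³≡1 : (ω ^ 2) ^ 3 ≡ 1#
    ω²³≡1 = trans (^-comm ω 2 3) (trans (cong (_^ 2) ω³≡1) (^-zeroˡ 2))
    ω[ωs]≡ω²s : ω * (ω * s) ≡ ω ^ 2 * s
    ω[ωs]≡ω²s = solve 2 (λ ω s → ω :* (ω :* s) := ω :^ 2 :* s) refl ω s

module Twists (𝔽 : FiniteField) (2≢0 : FiniteField.ι 𝔽 2 ≢ FiniteField.0# 𝔽)
              (3≢0 : FiniteField.ι 𝔽 3 ≢ FiniteField.0# 𝔽) where

  open FiniteField 𝔽 using (field')
  open FieldProperties field'
  open FiniteFieldProperties 𝔽
  open EC field'
  open WeierstrassProperties field' _≟_ 2≢0 3≢0 public

  enumerated : EnumeratedField
  enumerated = record { base = field' ; _≟_ = _≟_ ; elements = elements ; ∈-elements = ∈-elements }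

  private
    UnitRoot : ℕ → Carrier → Set₁
    UnitRoot n c = Σ[ K ∈ Field ] Σ[ h ∈ FieldHom field' K ] Σ[ u ∈ Field.Carrier K ]
                   (u ≢ Field.0# K) × (Field._^_ K u n ≡ FieldHom.map h c)

    unit-root : ∀ n {c} → 0 ℕ.< n → c ≢ 0# → ExtensionRoot n enumerated c → UnitRoot n c
    unit-root n 0<n c≢0 (E′ , h , u , uⁿ≡c) =
      EnumeratedField.base E′ , h , u , K.x^n≢0⇒x≢0 n 0<n (subst (_≢ K.0#) (sym uⁿ≡c) (map-≢0 c≢0)) , uⁿ≡c
      where
      module K = FieldProperties (EnumeratedField.base E′)
      open FieldHomProperties h using (map-≢0)

    map-0-scaled : ∀ {K} (h : FieldHom field' K) {x y} (v : Field.Carrier K) → x ≡ 0# → y ≡ 0# →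
                   FieldHom.map h y ≡ Field._*_ K v (FieldHom.map h x)
    map-0-scaled {K} h {x} {y} v x≡0 y≡0 = begin
      map y              ≡⟨ cong map y≡0 ⟩
      map 0#             ≡⟨ map-0 ⟩
      K.0#               ≡⟨ K.zeroʳ v ⟨
      v K.* K.0#         ≡⟨ cong (v K.*_) map-0 ⟨
      v K.* map 0#       ≡⟨ cong (λ t → v K.* map t) x≡0 ⟨
      v K.* map x        ∎
      where
      open ≡-Reasoning
      module K = FieldProperties K
      open FieldHom h
      open FieldHomProperties h using (map-0)

    map-scaled : ∀ {K} (h : FieldHom field' K) {x y c} (v : Field.Carrier K) → y ≡ c * x →
                 FieldHom.map h c ≡ v → FieldHom.map h y ≡ Field._*_ K v (FieldHom.map h x)
    map-scaled {K} h {x} {y} {c} v y≡cx hc≡v =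
      trans (cong map y≡cx) (trans (map-* c x) (cong (λ t → Field._*_ K t (map x)) hc≡v))
      where open FieldHom h

  IsoBar-b≡0 : ∀ {E T} → a E ≢ 0# → a T ≢ 0# → b E ≡ 0# → b T ≡ 0# → IsoBar E T
  IsoBar-b≡0 {E} {T} aE≢0 aT≢0 bE≡0 bT≡0 = from-root (unit-root 4 (s≤s z≤n) c≢0 (fourth-root enumerated c))
    where
    c = a T * a E ⁻¹
    c≢0 : c ≢ 0#
    c≢0 = x*y≢0 aT≢0 (x⁻¹≢0 aE≢0)
    from-root : UnitRoot 4 c → IsoBar E T
    from-root (K , h , u , u≢0 , u⁴≡c) = K , h , u , u≢0 ,
      map-scaled h _ (sym (*-⁻¹-cancelʳ (a T) aE≢0)) (sym u⁴≡c) , map-0-scaled h (Field._^_ K u 6) bE≡0 bT≡0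

  IsoBar-a≡0 : ∀ {E T} → b E ≢ 0# → b T ≢ 0# → a E ≡ 0# → a T ≡ 0# → IsoBar E T
  IsoBar-a≡0 {E} {T} bE≢0 bT≢0 aE≡0 aT≡0 = from-root (unit-root 6 (s≤s z≤n) c≢0 (sixth-root enumerated c))
    where
    c = b T * b E ⁻¹
    c≢0 : c ≢ 0#
    c≢0 = x*y≢0 bT≢0 (x⁻¹≢0 bE≢0)
    from-root : UnitRoot 6 c → IsoBar E T
    from-root (K , h , u , u≢0 , u⁶≡c) = K , h , u , u≢0 ,
      map-0-scaled h (Field._^_ K u 4) aE≡0 aT≡0 , map-scaled h _ (sym (*-⁻¹-cancelʳ (b T) bE≢0)) (sym u⁶≡c)

  IsoBar-quadratic : ∀ {E T D} → D ≢ 0# → a T ≡ D ^ 2 * a E → b T ≡ D ^ 3 * b E → IsoBar E T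
  IsoBar-quadratic {E} {T} {D} D≢0 aT≡ bT≡ = from-root (unit-root 2 (s≤s z≤n) D≢0 (square-root enumerated D))
    where
    from-root : UnitRoot 2 D → IsoBar E T
    from-root (K , h , u , u≢0 , u²≡D) = K , h , u , u≢0 , map-scaled h _ aT≡ (powers 2) , map-scaled h _ bT≡ (powers 3)
      where
      module K = FieldProperties K
      open FieldHomProperties h using (map-^)
      powers : ∀ n → FieldHom.map h (D ^ n) ≡ u K.^ (2 ℕ.* n)
      powers n = trans (map-^ D n) (trans (cong (K._^ n) (sym u²≡D)) (K.^-*-assoc u 2 n))

  private
    scaled-zero : ∀ {K} (h : FieldHom field' K) {x y} v →
                  FieldHom.map h y ≡ Field._*_ K v (FieldHom.map h x) → x ≡ 0# → y ≡ 0#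
    scaled-zero {K} h {x} {y} v hy≡vhx x≡0 with y ≟ 0#
    ... | yes y≡0 = y≡0
    ... | no  y≢0 = ⊥-elim (map-≢0 y≢0 (begin
      map y              ≡⟨ hy≡vhx ⟩
      v K.* map x        ≡⟨ cong (λ t → v K.* map t) x≡0 ⟩
      v K.* map 0#       ≡⟨ cong (v K.*_) map-0 ⟩
      v K.* K.0#         ≡⟨ K.zeroʳ v ⟩
      K.0#               ∎))
      where
      open ≡-Reasoning
      module K = FieldProperties K
      open FieldHom h using (map)
      open FieldHomProperties h using (map-0; map-≢0)

  IsoBar⇒b≡0 : ∀ {E T} → b E ≡ 0# → IsoBar E T → b T ≡ 0#
  IsoBar⇒b≡0 bE≡0 (_ , h , _ , _ , _ , hbT≡) = scaled-zero h _ hbT≡ bE≡0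

  IsoBar⇒a≡0 : ∀ {E T} → a E ≡ 0# → IsoBar E T → a T ≡ 0#
  IsoBar⇒a≡0 aE≡0 (_ , h , _ , _ , haT≡ , _) = scaled-zero h _ haT≡ aE≡0

  Twist-b≡0 : ∀ {E T} → IsEC E → b E ≡ 0# → IsEC T → b T ≡ 0# → Twist E T
  Twist-b≡0 E-isEC bE≡0 T-isEC bT≡0 =
    T-isEC , IsoBar-b≡0 (isEC∧b≡0⇒a≢0 E-isEC bE≡0) (isEC∧b≡0⇒a≢0 T-isEC bT≡0) bE≡0 bT≡0

  Twist-a≡0 : ∀ {E T} → IsEC E → a E ≡ 0# → IsEC T → a T ≡ 0# → Twist E T
  Twist-a≡0 E-isEC aE≡0 T-isEC aT≡0 =
    T-isEC , IsoBar-a≡0 (isEC∧a≡0⇒b≢0 E-isEC aE≡0) (isEC∧a≡0⇒b≢0 T-isEC aT≡0) aE≡0 aT≡0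

  -- A twist of E is a curve y² = x³ + a x, a ≠ 0, and two of them are isomorphic
  -- exactly when their a's differ by a fourth power.
  TwistElems-b≡0 : ∀ {n E} (T : Fin n → W) → IsEC E → b E ≡ 0# →
    (∀ i → b (T i) ≡ 0#) → (∀ i → a (T i) ≢ 0#) →
    (∀ {c} → c ≢ 0# → Σ[ i ∈ Fin n ] Σ[ s ∈ Carrier ] s ≢ 0# × c ≡ s ^ 4 * a (T i)) →
    (∀ {i j u} → u ≢ 0# → a (T j) ≡ u ^ 4 * a (T i) → i ≡ j) →
    TwistElems E T
  TwistElems-b≡0 {E = E} T E-isEC bE≡0 bT≡0 aT≢0 classify separate = twists , distinct , complete
    where
    twists : ∀ i → Twist E (T i)
    twists i = Twist-b≡0 E-isEC bE≡0 (isEC-b≡0 (bT≡0 i) (aT≢0 i)) (bT≡0 i)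
    distinct : ∀ i j → i ≢ j → ¬ Iso (T i) (T j)
    distinct i j i≢j (u , u≢0 , aTj≡ , _) = i≢j (separate u≢0 aTj≡)
    complete : ∀ T′ → Twist E T′ → Σ[ i ∈ Fin _ ] Iso T′ (T i)
    complete T′ (T′-isEC , isoBar) with classify (isEC∧b≡0⇒a≢0 T′-isEC (IsoBar⇒b≡0 bE≡0 isoBar))
    ... | i , s , s≢0 , aT′≡ = i , Iso-sym (Iso-b≡0 s≢0 (bT≡0 i) (IsoBar⇒b≡0 bE≡0 isoBar) aT′≡)

  TwistElems-a≡0 : ∀ {n E} (T : Fin n → W) → IsEC E → a E ≡ 0# →
    (∀ i → a (T i) ≡ 0#) → (∀ i → b (T i) ≢ 0#) →
    (∀ {c} → c ≢ 0# → Σ[ i ∈ Fin n ] Σ[ s ∈ Carrier ] s ≢ 0# × c ≡ s ^ 6 * b (T i)) →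
    (∀ {i j u} → u ≢ 0# → b (T j) ≡ u ^ 6 * b (T i) → i ≡ j) →
    TwistElems E T
  TwistElems-a≡0 {E = E} T E-isEC aE≡0 aT≡0 bT≢0 classify separate = twists , distinct , complete
    where
    twists : ∀ i → Twist E (T i)
    twists i = Twist-a≡0 E-isEC aE≡0 (isEC-a≡0 (aT≡0 i) (bT≢0 i)) (aT≡0 i)
    distinct : ∀ i j → i ≢ j → ¬ Iso (T i) (T j)
    distinct i j i≢j (u , u≢0 , _ , bTj≡) = i≢j (separate u≢0 bTj≡)
    complete : ∀ T′ → Twist E T′ → Σ[ i ∈ Fin _ ] Iso T′ (T i)
    complete T′ (T′-isEC , isoBar) with classify (isEC∧a≡0⇒b≢0 T′-isEC (IsoBar⇒a≡0 aE≡0 isoBar))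
    ... | i , s , s≢0 , bT′≡ = i , Iso-sym (Iso-a≡0 s≢0 (aT≡0 i) (IsoBar⇒a≡0 aE≡0 isoBar) bT′≡)

module Classification (𝔽 : FiniteField) (2≢0 : FiniteField.ι 𝔽 2 ≢ FiniteField.0# 𝔽)
                      (3≢0 : FiniteField.ι 𝔽 3 ≢ FiniteField.0# 𝔽) where

  open FiniteField 𝔽 using (field')
  open FieldProperties field'
  open FiniteFieldProperties 𝔽
  open EC field'
  open Twists 𝔽 2≢0 3≢0
  open ≡-Reasoning

  -- Part (1): j = 1728

  module _ {E : W} (E-isEC : IsEC E) (j≡1728 : j E ≡ ι 1728) where

    private
      bE≡0 : b E ≡ 0#
      bE≡0 = j≡1728⇒b≡0 E-isEC j≡1728
      aE≢0 : a E ≢ 0#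
      aE≢0 = isEC∧b≡0⇒a≢0 E-isEC bE≡0
      bH≡0 : b (Hess E) ≡ 0#
      bH≡0 = b-Hess-b≡0 {E} bE≡0
      aH≢0 : a (Hess E) ≢ 0#
      aH≢0 aH≡0 = -1≢0 (trans (sym (a-Hess-b≡0 {E} bE≡0 aE≢0)) (trans (cong (_* (ι 3 * a E)) aH≡0) (zeroˡ _)))

    Hess-j≡1728 : IsEC (Hess E) × (j (Hess E) ≡ ι 1728)
    Hess-j≡1728 = isEC-b≡0 {Hess E} bH≡0 aH≢0 , j-b≡0 {Hess E} bH≡0 aH≢0

    ProperTwist-Hess⇔ : ProperTwist E (Hess E) ⇔ (¬ (Σ[ t ∈ Carrier ] (t ≢ 0#) × (t ^ 4 ≡ - (ι 3 * (a E ^ 2)))))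
    ProperTwist-Hess⇔ = mk⇔ to from
      where
      to : ProperTwist E (Hess E) → ¬ (Σ[ t ∈ Carrier ] (t ≢ 0#) × (t ^ 4 ≡ - (ι 3 * (a E ^ 2))))
      to (_ , ¬iso) root = ¬iso (Equivalence.from (Iso-Hess-b≡0 {E} bE≡0 aE≢0) root)
      from : ¬ (Σ[ t ∈ Carrier ] (t ≢ 0#) × (t ^ 4 ≡ - (ι 3 * (a E ^ 2)))) → ProperTwist E (Hess E)
      from ¬root = Twist-b≡0 {E} {Hess E} E-isEC bE≡0 (proj₁ Hess-j≡1728) bH≡0 ,
                   λ iso → ¬root (Equivalence.to (Iso-Hess-b≡0 {E} bE≡0 aE≢0) iso)

  Twist-Hess-W₋₈ : ∀ {E s} → IsEC E → b E ≡ 0# → s ≢ 0# → Twist E (Hess (W₋₈ s))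
  Twist-Hess-W₋₈ E-isEC bE≡0 s≢0 =
    Twist-b≡0 E-isEC bE≡0 (isEC-b≡0 (b-Hess-W₋₈ s≢0) (a-Hess-W₋₈≢0 s≢0)) (b-Hess-W₋₈ s≢0)

  ProperTwist-W₋₈ : ∀ {D} → D ≢ 0# → (∀ x → x ^ 2 ≢ D) → ProperTwist (W₋₈ 1#) (W₋₈ D)
  ProperTwist-W₋₈ {D} D≢0 D-nonsquare =
    (W₋₈-isEC D≢0 , IsoBar-quadratic D≢0
       (solve 1 (λ D → (:- # 6) :* D :^ 2 := D :^ 2 :* ((:- # 6) :* # 1 :^ 2)) refl D)
       (solve 1 (λ D → # 6 :* D :^ 3 := D :^ 3 :* (# 6 :* # 1 :^ 3)) refl D)) ,
    ¬Iso-W₋₈ D≢0 D-nonsquare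

  -- q ≡ 3 (mod 4): #units = 2m with m odd, so -1 is a non-square and every square is a fourth power.
  module _ (t : ℕ) (N≡ : 2 ℕ.* suc (2 ℕ.* t) ≡ #units) where

    private
      m = suc (2 ℕ.* t)

      -1ᵐ≢1 : (- 1#) ^ m ≢ 1#
      -1ᵐ≢1 -1ᵐ≡1 = -1≢1 2≢0 (trans (sym (-1^[1+2t]≡-1 t)) -1ᵐ≡1)

      open PowerClasses 2 m N≡ -1≢0 (order-two (trans (cong (_^ 2) (-1^[1+2t]≡-1 t)) -1²≡1) -1ᵐ≢1)

      fourth-power-classes : ∀ {c} → c ≢ 0# → Σ[ j ∈ Fin 2 ] Σ[ r ∈ Carrier ] r ≢ 0# × c ≡ r ^ 4 * (- 1#) ^ toℕ j
      fourth-power-classes {c} c≢0 = refine (classify c≢0)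
        where
        g = - 1#
        gⁱ²≡1 : ∀ i → (g ^ i) ^ 2 ≡ 1#
        gⁱ²≡1 i = trans (^-comm g i 2) (trans (cong (_^ i) -1²≡1) (^-zeroˡ i))
        refine : Σ[ j ∈ Fin 2 ] Σ[ s ∈ Carrier ] s ≢ 0# × c ≡ s ^ 2 * g ^ toℕ j →
                 Σ[ j ∈ Fin 2 ] Σ[ r ∈ Carrier ] r ≢ 0# × c ≡ r ^ 4 * g ^ toℕ j
        refine (j , s , s≢0 , c≡s²gʲ) = square-of (classify s≢0)
          where
          square-of : Σ[ i ∈ Fin 2 ] Σ[ r ∈ Carrier ] r ≢ 0# × s ≡ r ^ 2 * g ^ toℕ i →
                      Σ[ j ∈ Fin 2 ] Σ[ r ∈ Carrier ] r ≢ 0# × c ≡ r ^ 4 * g ^ toℕ j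
          square-of (i , r , r≢0 , s≡r²gⁱ) = j , r , r≢0 , (begin
            c                                          ≡⟨ c≡s²gʲ ⟩
            s ^ 2 * g ^ toℕ j                          ≡⟨ cong (λ x → x ^ 2 * g ^ toℕ j) s≡r²gⁱ ⟩
            (r ^ 2 * g ^ toℕ i) ^ 2 * g ^ toℕ j        ≡⟨ solve 3 (λ r x y → (r :^ 2 :* x) :^ 2 :* y := r :^ 4 :* (x :^ 2 :* y)) refl r (g ^ toℕ i) (g ^ toℕ j) ⟩
            r ^ 4 * ((g ^ toℕ i) ^ 2 * g ^ toℕ j)      ≡⟨ cong (λ x → r ^ 4 * (x * g ^ toℕ j)) (gⁱ²≡1 (toℕ i)) ⟩
            r ^ 4 * (1# * g ^ toℕ j)                   ≡⟨ cong (r ^ 4 *_) (*-identityˡ _) ⟩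
            r ^ 4 * g ^ toℕ j                          ∎)

    TwistCard-q≡3[4] : ∀ {E} → IsEC E → b E ≡ 0# → TwistCard E 2
    TwistCard-q≡3[4] E-isEC bE≡0 = T , TwistElems-b≡0 T E-isEC bE≡0 (λ _ → refl) (λ i → x^n≢0 (toℕ i) -1≢0)
      fourth-power-classes
      (λ {i} {j} {u} u≢0 aTj≡ → separate {i} {j} {u ^ 2} {1#} (x^n≢0 2 u≢0) 1≢0
        (trans (cong (_* (- 1#) ^ toℕ i) (^-*-assoc u 2 2)) (trans (sym aTj≡) (sym (1ⁿ*x≡x 2 _)))))
      where
      T : Fin 2 → W
      T i = mkW ((- 1#) ^ toℕ i) 0#

    Hessians-q≡3[4] : ∀ {E} → IsEC E → b E ≡ 0# →
      Σ[ E₁ ∈ W ] Σ[ E₂ ∈ W ]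
        IsEC E₁ × IsEC E₂ × (j E₁ ≡ - (ι 8 * ι 1728)) × (j E₂ ≡ - (ι 8 * ι 1728)) ×
        ProperTwist E₁ E₂ × Twist E (Hess E₁) × Iso (Hess E₁) (Hess E₂)
    Hessians-q≡3[4] E-isEC bE≡0 =
      W₋₈ 1# , W₋₈ (- 1#) , W₋₈-isEC 1≢0 , W₋₈-isEC -1≢0 , j-W₋₈ 1≢0 , j-W₋₈ -1≢0 ,
      ProperTwist-W₋₈ -1≢0 (non-residue⇒∄root 2 m N≡ -1≢0 -1ᵐ≢1) ,
      Twist-Hess-W₋₈ E-isEC bE≡0 1≢0 , ≡⇒Iso (cong a H₂≡H₁) (cong b H₂≡H₁)
      where
      H₂≡H₁ : Hess (W₋₈ (- 1#)) ≡ Hess (W₋₈ 1#)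
      H₂≡H₁ = trans (Hess-W₋₈ -1≢0) (trans (cong (λ x → mkW (- ((ι 36 * x) ⁻¹)) 0#) (trans -1²≡1 (sym (^-zeroˡ 2))))
                                           (sym (Hess-W₋₈ 1≢0)))

  -- q ≡ 1 (mod 4): #units = 4m, and for a non-square D, D ^ m is a primitive fourth root of unity.
  module _ (m : ℕ) (N≡ : 4 ℕ.* m ≡ #units) where

    private
      2[2m]≡N : 2 ℕ.* (2 ℕ.* m) ≡ #units
      2[2m]≡N = trans (sym (ℕ.*-assoc 2 2 m)) N≡

      residue = non-residue 2 (2 ℕ.* m) (s≤s (s≤s z≤n)) 2[2m]≡N
      D = proj₁ residue
      D≢0 : D ≢ 0#
      D≢0 = proj₁ (proj₂ residue)
      D²ᵐ≢1 : D ^ (2 ℕ.* m) ≢ 1#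
      D²ᵐ≢1 = proj₂ (proj₂ residue)

      D-nonsquare : ∀ x → x ^ 2 ≢ D
      D-nonsquare = non-residue⇒∄root 2 (2 ℕ.* m) 2[2m]≡N D≢0 D²ᵐ≢1

      open PowerClasses 4 m N≡ D≢0 (order-four (^-#units≡1 m 4 (trans (ℕ.*-comm m 4) N≡) D≢0)
        (λ Dᵐ²≡1 → D²ᵐ≢1 (trans (cong (D ^_) (ℕ.*-comm 2 m)) (trans (sym (^-*-assoc D m 2)) Dᵐ²≡1))))

    TwistCard-q≡1[4] : ∀ {E} → IsEC E → b E ≡ 0# → TwistCard E 4
    TwistCard-q≡1[4] E-isEC bE≡0 = T , TwistElems-b≡0 T E-isEC bE≡0 (λ _ → refl) (λ i → x^n≢0 (toℕ i) D≢0)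
      classify (λ {i} {j} {u} u≢0 aTj≡ → separate {i} {j} {u} {1#} u≢0 1≢0 (trans (sym aTj≡) (sym (1ⁿ*x≡x 4 _))))
      where
      T : Fin 4 → W
      T i = mkW (D ^ toℕ i) 0#

    Hessians-q≡1[4] : ∀ {E} → IsEC E → b E ≡ 0# →
      Σ[ E₁ ∈ W ] Σ[ E₂ ∈ W ]
        IsEC E₁ × IsEC E₂ × (j E₁ ≡ - (ι 8 * ι 1728)) × (j E₂ ≡ - (ι 8 * ι 1728)) ×
        ProperTwist E₁ E₂ × Twist E (Hess E₁) × Twist E (Hess E₂) × ¬ Iso (Hess E₁) (Hess E₂)
    Hessians-q≡1[4] E-isEC bE≡0 =
      W₋₈ 1# , W₋₈ D , W₋₈-isEC 1≢0 , W₋₈-isEC D≢0 , j-W₋₈ 1≢0 , j-W₋₈ D≢0 ,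
      ProperTwist-W₋₈ D≢0 D-nonsquare ,
      Twist-Hess-W₋₈ E-isEC bE≡0 1≢0 , Twist-Hess-W₋₈ E-isEC bE≡0 D≢0 , ¬iso
      where
      -- An isomorphism would give u⁴ D² = 1: D² and D⁰ would agree modulo fourth powers.
      ¬iso : ¬ Iso (Hess (W₋₈ 1#)) (Hess (W₋₈ D))
      ¬iso iso = impossible (Iso-Hess-W₋₈ 1≢0 D≢0 iso)
        where
        impossible : ¬ (Σ[ u ∈ Carrier ] u ≢ 0# × 1# ^ 2 ≡ u ^ 4 * D ^ 2)
        impossible (u , u≢0 , 1²≡u⁴D²) = Fin.0≢1+n (sym (separate {2F} {0F} {u} {1#} u≢0 1≢0
          (trans (sym 1²≡u⁴D²) (solve 0 (# 1 :^ 2 := # 1 :^ 4 :* # 1) refl))))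

  -- Part (2): j = 0

  -- q ≡ 2 (mod 3): 3 is prime to #units = 3t + 1, so every unit is a cube and the classes modulo
  -- sixth powers are the classes modulo squares, represented by 1 and the non-square D³.
  module _ (t : ℕ) (N≡₃ : 3 ℕ.* t ℕ.+ 1 ≡ #units) (m : ℕ) (N≡₂ : 2 ℕ.* m ≡ #units) where

    private
      residue = non-residue 2 m (s≤s (s≤s z≤n)) N≡₂
      D = proj₁ residue
      D≢0 : D ≢ 0#
      D≢0 = proj₁ (proj₂ residue)
      Dᵐ≢1 : D ^ m ≢ 1#
      Dᵐ≢1 = proj₂ (proj₂ residue)

      D³≢0 : D ^ 3 ≢ 0#
      D³≢0 = x^n≢0 3 D≢0

      D³ᵐ≢1 : (D ^ 3) ^ m ≢ 1#
      D³ᵐ≢1 D³ᵐ≡1 = Dᵐ≢1 (begin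
        D ^ m                    ≡⟨ *-identityʳ _ ⟨
        D ^ m * 1#               ≡⟨ cong (D ^ m *_) (^-#units≡1 m 2 (trans (ℕ.*-comm m 2) N≡₂) D≢0) ⟨
        (D ^ m) ^ 3              ≡⟨ ^-comm D m 3 ⟩
        (D ^ 3) ^ m              ≡⟨ D³ᵐ≡1 ⟩
        1#                       ∎)

      open PowerClasses 2 m N≡₂ D³≢0 (order-two (^-#units≡1 m 2 (trans (ℕ.*-comm m 2) N≡₂) D³≢0) D³ᵐ≢1)

      sixth-power-classes : ∀ {c} → c ≢ 0# → Σ[ j ∈ Fin 2 ] Σ[ w ∈ Carrier ] w ≢ 0# × c ≡ w ^ 6 * (D ^ 3) ^ toℕ j
      sixth-power-classes {c} c≢0 = cube-root-of (classify c≢0)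
        where
        cube-root-of : Σ[ j ∈ Fin 2 ] Σ[ s ∈ Carrier ] s ≢ 0# × c ≡ s ^ 2 * (D ^ 3) ^ toℕ j →
                       Σ[ j ∈ Fin 2 ] Σ[ w ∈ Carrier ] w ≢ 0# × c ≡ w ^ 6 * (D ^ 3) ^ toℕ j
        cube-root-of (j , s , s≢0 , c≡s²gʲ) = j , w , x^n≢0 (2 ℕ.* t ℕ.+ 1) s≢0 , (begin
          c                              ≡⟨ c≡s²gʲ ⟩
          s ^ 2 * (D ^ 3) ^ toℕ j        ≡⟨ cong (λ x → x ^ 2 * (D ^ 3) ^ toℕ j) (kth-root-of-coprime 2 t N≡₃ s≢0) ⟨
          (w ^ 3) ^ 2 * (D ^ 3) ^ toℕ j  ≡⟨ cong (_* (D ^ 3) ^ toℕ j) (^-*-assoc w 3 2) ⟩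
          w ^ 6 * (D ^ 3) ^ toℕ j        ∎)
          where w = s ^ (2 ℕ.* t ℕ.+ 1)

    Twists-q≡2[3] : ∀ {E} → IsEC E → a E ≡ 0# →
      Σ[ f ∈ (Fin 2 → W) ]
        TwistElems E f × IsQuadTwist (f 0F) (f 1F) ×
        (Σ[ E₁ ∈ W ] Σ[ E₂ ∈ W ]
           IsEC E₁ × IsEC E₂ × (j E₁ ≡ ι 4 * ι 1728) × (j E₂ ≡ ι 4 * ι 1728) ×
           IsQuadTwist E₁ E₂ × Iso (Hess E₁) (f 0F) × Iso (Hess E₂) (f 1F))
    Twists-q≡2[3] E-isEC aE≡0 =
      T , TwistElems-a≡0 T E-isEC aE≡0 (λ _ → refl) (λ i → x^n≢0 (toℕ i) D³≢0) sixth-power-classes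
          (λ {i} {j} {u} u≢0 bTj≡ → separate {i} {j} {u ^ 3} {1#} (x^n≢0 3 u≢0) 1≢0
             (trans (cong (_* (D ^ 3) ^ toℕ i) (^-*-assoc u 3 2)) (trans (sym bTj≡) (sym (1ⁿ*x≡x 2 _))))) ,
      (D , D-nonsquare , ≡⇒Iso (zeroʳ _) refl) ,
      W₄ 1# , W₄ D , W₄-isEC 1≢0 , W₄-isEC D≢0 , j-W₄ 1≢0 , j-W₄ D≢0 ,
      (D , D-nonsquare , ≡⇒Iso (solve 1 (λ D → D :^ 2 :* ((:- # 9) :* # 1 :^ 2) := (:- # 9) :* D :^ 2) refl D)
                               (solve 1 (λ D → D :^ 3 :* (# 9 :* # 1 :^ 3) := # 9 :* D :^ 3) refl D)) ,
      Iso-Hess-W₄ 1≢0 refl (sym (^-zeroˡ 3)) , Iso-Hess-W₄ D≢0 refl (*-identityʳ _)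
      where
      T : Fin 2 → W
      T i = mkW 0# ((D ^ 3) ^ toℕ i)
      D-nonsquare : NonSquare D
      D-nonsquare = ^2⇒NonSquare (non-residue⇒∄root 2 m N≡₂ D≢0 Dᵐ≢1)

  -- q ≡ 1 (mod 3): the classes modulo sixth powers are told apart by the quadratic character
  -- x ↦ x ^ m₂ and the cubic character x ↦ x ^ m₃; they are represented by (D ^ e)³ w ^ d
  -- (e < 2, d < 3) for a non-square D and a square non-cube w = a₃².
  module _ (m₃ : ℕ) (N≡₃ : 3 ℕ.* m₃ ≡ #units) (m₂ : ℕ) (N≡₂ : 2 ℕ.* m₂ ≡ #units) where

    private
      quadratic-residue = non-residue 2 m₂ (s≤s (s≤s z≤n)) N≡₂
      D = proj₁ quadratic-residue
      D≢0 : D ≢ 0#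
      D≢0 = proj₁ (proj₂ quadratic-residue)
      Dᵐ≢1 : D ^ m₂ ≢ 1#
      Dᵐ≢1 = proj₂ (proj₂ quadratic-residue)

      cubic-residue = non-residue 3 m₃ (s≤s (s≤s z≤n)) N≡₃
      a₃ = proj₁ cubic-residue
      a₃≢0 : a₃ ≢ 0#
      a₃≢0 = proj₁ (proj₂ cubic-residue)
      a₃ᵐ≢1 : a₃ ^ m₃ ≢ 1#
      a₃ᵐ≢1 = proj₂ (proj₂ cubic-residue)

      w = a₃ ^ 2
      w≢0 : w ≢ 0#
      w≢0 = x^n≢0 2 a₃≢0
      ω = w ^ m₃

      ω-primitive : IsPrimitiveRoot 3 ω
      ω-primitive = order-three (^-#units≡1 m₃ 3 (trans (ℕ.*-comm m₃ 3) N≡₃) w≢0) ω≢1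
        where
        ω≢1 : ω ≢ 1#
        ω≢1 ω≡1 = a₃ᵐ≢1 (begin
          a₃ ^ m₃                   ≡⟨ *-identityʳ _ ⟨
          a₃ ^ m₃ * 1#              ≡⟨ cong (a₃ ^ m₃ *_) (trans (sym (^-comm a₃ 2 m₃)) ω≡1) ⟨
          (a₃ ^ m₃) ^ 3             ≡⟨ ^-#units≡1 m₃ 3 (trans (ℕ.*-comm m₃ 3) N≡₃) a₃≢0 ⟩
          1#                        ∎)

      module Cubic     = PowerClasses 3 m₃ N≡₃ w≢0 ω-primitive
      module Quadratic = PowerClasses 2 m₂ N≡₂ D≢0
        (order-two (^-#units≡1 m₂ 2 (trans (ℕ.*-comm m₂ 2) N≡₂) D≢0) Dᵐ≢1)

      g : Fin 3 → W
      g d = mkW 0# (w ^ toℕ d)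

      P : Fin 6 → W
      P = pairs 3 g D

      split : Fin 6 → Fin 2 × Fin 3
      split = remQuot {2} 3

      a-P : ∀ i → a (P i) ≡ 0#
      a-P 0F = refl
      a-P 1F = refl
      a-P 2F = refl
      a-P (Fin.suc (Fin.suc (Fin.suc i))) = zeroʳ _

      b-P-combine : ∀ (e : Fin 2) (d : Fin 3) → b (P (combine e d)) ≡ (D ^ toℕ e) ^ 3 * w ^ toℕ d
      b-P-combine 0F 0F = sym (1ⁿ*x≡x 3 _)
      b-P-combine 0F 1F = sym (1ⁿ*x≡x 3 _)
      b-P-combine 0F 2F = sym (1ⁿ*x≡x 3 _)
      b-P-combine 1F 0F = cong (λ x → x ^ 3 * 1#) (sym (*-identityʳ D))
      b-P-combine 1F 1F = cong (λ x → x ^ 3 * w ^ 1) (sym (*-identityʳ D))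
      b-P-combine 1F 2F = cong (λ x → x ^ 3 * w ^ 2) (sym (*-identityʳ D))

      b-P : ∀ i → b (P i) ≡ (D ^ toℕ (proj₁ (split i))) ^ 3 * w ^ toℕ (proj₂ (split i))
      b-P i = subst (λ k → b (P k) ≡ (D ^ toℕ (proj₁ (split i))) ^ 3 * w ^ toℕ (proj₂ (split i)))
                    (Fin.combine-remQuot {2} 3 i) (b-P-combine (proj₁ (split i)) (proj₂ (split i)))

      b-P≢0 : ∀ i → b (P i) ≢ 0#
      b-P≢0 i = subst (_≢ 0#) (sym (b-P i)) (x*y≢0 (x^n≢0 3 (x^n≢0 (toℕ (proj₁ (split i))) D≢0)) (x^n≢0 (toℕ (proj₂ (split i))) w≢0))

      sixth-power-classes : ∀ {c} → c ≢ 0# → Σ[ i ∈ Fin 6 ] Σ[ s ∈ Carrier ] s ≢ 0# × c ≡ s ^ 6 * b (P i)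
      sixth-power-classes {c} c≢0 = square-class-of (Cubic.classify c≢0)
        where
        square-class-of : Σ[ d ∈ Fin 3 ] Σ[ t ∈ Carrier ] t ≢ 0# × c ≡ t ^ 3 * w ^ toℕ d →
                          Σ[ i ∈ Fin 6 ] Σ[ s ∈ Carrier ] s ≢ 0# × c ≡ s ^ 6 * b (P i)
        square-class-of (d , t , t≢0 , c≡t³wᵈ) = combine-classes (Quadratic.classify t≢0)
          where
          combine-classes : Σ[ e ∈ Fin 2 ] Σ[ s ∈ Carrier ] s ≢ 0# × t ≡ s ^ 2 * D ^ toℕ e →
                            Σ[ i ∈ Fin 6 ] Σ[ s ∈ Carrier ] s ≢ 0# × c ≡ s ^ 6 * b (P i)
          combine-classes (e , s , s≢0 , t≡s²Dᵉ) = combine e d , s , s≢0 , (begin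
            c                                           ≡⟨ c≡t³wᵈ ⟩
            t ^ 3 * w ^ toℕ d                           ≡⟨ cong (λ x → x ^ 3 * w ^ toℕ d) t≡s²Dᵉ ⟩
            (s ^ 2 * D ^ toℕ e) ^ 3 * w ^ toℕ d         ≡⟨ solve 3 (λ s X Y → (s :^ 2 :* X) :^ 3 :* Y := s :^ 6 :* (X :^ 3 :* Y))
                                                             refl s (D ^ toℕ e) (w ^ toℕ d) ⟩
            s ^ 6 * ((D ^ toℕ e) ^ 3 * w ^ toℕ d)       ≡⟨ cong (s ^ 6 *_) (b-P-combine e d) ⟨
            s ^ 6 * b (P (combine e d))                 ∎)

      -- (D ^ e)³ w ^ d is (D ^ e)³ times a square and (D ^ e a₃ ^ d)² times D ^ e.
      separate : ∀ {i j u} → u ≢ 0# → b (P j) ≡ u ^ 6 * b (P i) → i ≡ j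
      separate {i} {j} {u} u≢0 bPj≡ = begin
        i                           ≡⟨ Fin.combine-remQuot {2} 3 i ⟨
        uncurry combine (split i)   ≡⟨ cong₂ combine e≡e′ d≡d′ ⟩
        uncurry combine (split j)   ≡⟨ Fin.combine-remQuot {2} 3 j ⟩
        j                           ∎
        where
        e = proj₁ (split i)
        d = proj₂ (split i)
        e′ = proj₁ (split j)
        d′ = proj₂ (split j)
        X = D ^ toℕ e
        X′ = D ^ toℕ e′
        eq : X′ ^ 3 * w ^ toℕ d′ ≡ u ^ 6 * (X ^ 3 * w ^ toℕ d)
        eq = trans (sym (b-P j)) (trans bPj≡ (cong (u ^ 6 *_) (b-P i)))
        wᵈ≡ : ∀ d → w ^ d ≡ (a₃ ^ d) ^ 2
        wᵈ≡ d = ^-comm a₃ 2 d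
        d≡d′ : d ≡ d′
        d≡d′ = Cubic.separate {d} {d′} {u ^ 2 * X} {X′} (x*y≢0 (x^n≢0 2 u≢0) (x^n≢0 (toℕ e) D≢0)) (x^n≢0 (toℕ e′) D≢0) (begin
          (u ^ 2 * X) ^ 3 * w ^ toℕ d     ≡⟨ solve 3 (λ u X Y → (u :^ 2 :* X) :^ 3 :* Y := u :^ 6 :* (X :^ 3 :* Y)) refl u X (w ^ toℕ d) ⟩
          u ^ 6 * (X ^ 3 * w ^ toℕ d)     ≡⟨ eq ⟨
          X′ ^ 3 * w ^ toℕ d′             ∎)
        e≡e′ : e ≡ e′
        e≡e′ = Quadratic.separate {e} {e′} {u ^ 3 * (X * a₃ ^ toℕ d)} {X′ * a₃ ^ toℕ d′}
          (x*y≢0 (x^n≢0 3 u≢0) (x*y≢0 (x^n≢0 (toℕ e) D≢0) (x^n≢0 (toℕ d) a₃≢0))) (x*y≢0 (x^n≢0 (toℕ e′) D≢0) (x^n≢0 (toℕ d′) a₃≢0)) (begin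
          (u ^ 3 * (X * a₃ ^ toℕ d)) ^ 2 * X    ≡⟨ solve 4 (λ u X A Y → (u :^ 3 :* (X :* A)) :^ 2 :* X := u :^ 6 :* (X :^ 3 :* A :^ 2))
                                                     refl u X (a₃ ^ toℕ d) (w ^ toℕ d) ⟩
          u ^ 6 * (X ^ 3 * (a₃ ^ toℕ d) ^ 2)    ≡⟨ cong (λ y → u ^ 6 * (X ^ 3 * y)) (wᵈ≡ (toℕ d)) ⟨
          u ^ 6 * (X ^ 3 * w ^ toℕ d)           ≡⟨ eq ⟨
          X′ ^ 3 * w ^ toℕ d′                   ≡⟨ cong (λ y → X′ ^ 3 * y) (wᵈ≡ (toℕ d′)) ⟩
          X′ ^ 3 * (a₃ ^ toℕ d′) ^ 2            ≡⟨ solve 2 (λ X A → X :^ 3 :* A :^ 2 := (X :* A) :^ 2 :* X) refl X′ (a₃ ^ toℕ d′) ⟩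
          (X′ * a₃ ^ toℕ d′) ^ 2 * X′           ∎)

    Twists-q≡1[3] : ∀ {E} → IsEC E → a E ≡ 0# →
      Σ[ g ∈ (Fin 3 → W) ] Σ[ D ∈ Carrier ]
        NonSquare D × TwistElems E (pairs 3 g D) ×
        (Σ[ i ∈ Fin 3 ] HessOfThree (g i) × HessOfThree (qtw D (g i)))
    Twists-q≡1[3] E-isEC aE≡0 =
      g , D , ^2⇒NonSquare (non-residue⇒∄root 2 m₂ N≡₂ D≢0 Dᵐ≢1) ,
      TwistElems-a≡0 P E-isEC aE≡0 a-P b-P≢0 sixth-power-classes separate ,
      0F , HessOfThree-W₄ ω-primitive 1≢0 refl (sym (^-zeroˡ 3)) , HessOfThree-W₄ ω-primitive D≢0 (zeroʳ _) (*-identityʳ _)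

open import Data.Nat using (_≤_; _^_; _%_)

proposition5p1 :
  (p q : ℕ) → Prime p → p ≢ 2 → p ≢ 3 → (Σ[ k ∈ ℕ ] (1 ≤ k) × (q ≡ p ^ k)) →
  (𝔽 : FiniteField) → FiniteField.size 𝔽 ≡ q →
  let F = FiniteField.field' 𝔽
      open Field F hiding (_^_)
      open Field F using () renaming (_^_ to _^F_)
      open EC F
  in ι p ≡ 0# →
  (E' : W) → IsEC E' →
  -- (1) j(E') = 1728
  ((j E' ≡ ι 1728 →
      (IsEC (Hess E') × (j (Hess E') ≡ ι 1728)) ×
      (ProperTwist E' (Hess E')
         ⇔ (¬ (Σ[ t ∈ Carrier ] (t ≢ 0#) × ((t ^F 4) ≡ - (ι 3 * (a E' ^F 2)))))) ×
      -- (a) q ≡ 3 mod 4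
      ((q % 4 ≡ 3 →
          TwistCard E' 2 ×
          (Σ[ E₁ ∈ W ] Σ[ E₂ ∈ W ]
             IsEC E₁ × IsEC E₂ ×
             (j E₁ ≡ - (ι 8 * ι 1728)) × (j E₂ ≡ - (ι 8 * ι 1728)) ×
             ProperTwist E₁ E₂ ×
             Twist E' (Hess E₁) × Iso (Hess E₁) (Hess E₂))) ×
      -- (b) q ≡ 1 mod 4
       (q % 4 ≡ 1 →
          TwistCard E' 4 ×
          (Σ[ E₁ ∈ W ] Σ[ E₂ ∈ W ]
             IsEC E₁ × IsEC E₂ ×
             (j E₁ ≡ - (ι 8 * ι 1728)) × (j E₂ ≡ - (ι 8 * ι 1728)) ×
             ProperTwist E₁ E₂ ×
             Twist E' (Hess E₁) × Twist E' (Hess E₂) ×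
             ¬ Iso (Hess E₁) (Hess E₂))))) ×
  -- (2) j(E') = 0
   (j E' ≡ 0# →
      -- (a) q ≡ 2 mod 3
      (q % 3 ≡ 2 →
          Σ[ f ∈ (Fin 2 → W) ]
            TwistElems E' f × IsQuadTwist (f 0F) (f 1F) ×
            (Σ[ E₁ ∈ W ] Σ[ E₂ ∈ W ]
               IsEC E₁ × IsEC E₂ ×
               (j E₁ ≡ ι 4 * ι 1728) × (j E₂ ≡ ι 4 * ι 1728) ×
               IsQuadTwist E₁ E₂ ×
               Iso (Hess E₁) (f 0F) × Iso (Hess E₂) (f 1F))) ×
      -- (b) q ≡ 1 mod 3
      (q % 3 ≡ 1 →
          Σ[ g ∈ (Fin 3 → W) ] Σ[ D ∈ Carrier ]
            NonSquare D × TwistElems E' (pairs 3 g D) ×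
            (Σ[ i ∈ Fin 3 ] HessOfThree (g i) × HessOfThree (qtw D (g i))))))
proposition5p1 p q p-prime p≢2 p≢3 _ 𝔽 size≡q ιp≡0 E′ E′-isEC =
  (λ j≡1728 → let bE′≡0 = j≡1728⇒b≡0 E′-isEC j≡1728 in
    Hess-j≡1728 E′-isEC j≡1728 , ProperTwist-Hess⇔ E′-isEC j≡1728 ,
    (λ q%4≡3 → let N≡ = q%4≡3⇒ 1+N≡q q%4≡3 in
       TwistCard-q≡3[4] (q ℕ./ 4) N≡ E′-isEC bE′≡0 , Hessians-q≡3[4] (q ℕ./ 4) N≡ E′-isEC bE′≡0) ,
    (λ q%4≡1 → let N≡ = q%4≡1⇒ 1+N≡q q%4≡1 in
       TwistCard-q≡1[4] (q ℕ./ 4) N≡ E′-isEC bE′≡0 , Hessians-q≡1[4] (q ℕ./ 4) N≡ E′-isEC bE′≡0)) ,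
  (λ j≡0 → let aE′≡0 = j≡0⇒a≡0 E′-isEC j≡0 in
    (λ q%3≡2 → Twists-q≡2[3] (q ℕ./ 3) (q%3≡2⇒ 1+N≡q q%3≡2) m₂ N≡₂ E′-isEC aE′≡0) ,
    (λ q%3≡1 → Twists-q≡1[3] (q ℕ./ 3) (q%3≡1⇒ 1+N≡q q%3≡1) m₂ N≡₂ E′-isEC aE′≡0))
  where
  open FiniteField 𝔽 using (field')
  open FieldProperties field' using (ι; 0#; ι-coprime)
  open FiniteFieldProperties 𝔽 using (#units; suc-#units; #units-even)

  2<p : 2 ℕ.< p
  2<p = ℕ.≤∧≢⇒< (ℕ.nonTrivial⇒n>1 p {{prime⇒nonTrivial p-prime}}) (≢-sym p≢2)

  2≢0 : ι 2 ≢ 0#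
  2≢0 = ι-coprime (prime⇒coprime p-prime 2<p) ιp≡0
  3≢0 : ι 3 ≢ 0#
  3≢0 = ι-coprime (prime⇒coprime p-prime (ℕ.≤∧≢⇒< 2<p (≢-sym p≢3))) ιp≡0
  open Twists 𝔽 2≢0 3≢0 using (j≡1728⇒b≡0; j≡0⇒a≡0)
  open Classification 𝔽 2≢0 3≢0

  1+N≡q : suc #units ≡ q
  1+N≡q = trans suc-#units size≡q
  m₂ : ℕ
  m₂ = proj₁ (#units-even 2≢0)
  N≡₂ : 2 ℕ.* m₂ ≡ #units
  N≡₂ = proj₂ (#units-even 2≢0)
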